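{- Let $D^{(s)}_{max}=\{x\in V:(x,\alpha)\le1\ (\alpha\in\Pi_s),\ (x,\alpha)\le0\ (\alpha\in\Pi_l),\ (x,\theta)\ge1\}$. (1) An element $w=v\cdot t_r\in\widehat W$ ($v\in W$, $r\in Q^\vee$) is $s$-maximal if and only if $w$ is dominant and $v(r)\in D^{(s)}_{max}\cap Q^\vee$. (2) The map from the set of $s$-maximal elements to $D^{(s)}_{max}\cap Q^\vee$, $w=v\cdot t_r\mapsto v(r)$, is a bijection.
   Context: Let $\Delta$ be an irreducible reduced crystallographic root system with two root lengths in a real Euclidean space $V$ with $W$-invariant inner product $(\cdot,\cdot)$; $W$ its Weyl group, $\Delta^+$ positive roots, $\Pi=\{\alpha_1,\dots,\alpha_p\}$ simple roots, $\Pi_s,\Pi_l$ short/long simple roots, $\theta$ the highest root, $\mu^\vee=2\mu/(\mu,\mu)$, $Q^\vee=\bigoplus\mathbb Z\alpha_i^\vee$. Affine setting: $\widehat V=V\oplus\mathbb R\delta\oplus\mathbb R\lambda$ with $(\delta,V)=(\lambda,V)=(\delta,\delta)=(\lambda,\lambda)=0$, $(\delta,\lambda)=1$; affine roots $\mu+k\delta$, positive affine roots $\widehat\Delta^+=\Delta^+\cup\{\mu+k\delta:\mu\in\Delta,k\ge1\}$, $\widehat\Pi=\Pi\cup\{\alpha_0=\delta-\theta\}$, $\widehat\Pi_l=\Pi_l\cup\{\alpha_0\}$. $\widehat W$ is generated by the reflections of $\widehat V$ in $\widehat\Pi$; each $w$ is uniquely $w=v\cdot t_r$ with $v\in W$ (fixing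 $\delta$), $r\in Q^\vee$, $t_r(x)=x-(x,r)\delta$ on $V\oplus\mathbb R\delta$. $w$ is dominant if $w(\alpha)\in\widehat\Delta^+$ for all $\alpha\in\Pi$; $w$ is $s$-maximal if it is dominant and, writing $w^{ -1}(\alpha)=\mu+k\delta$ ($\mu\in\Delta$), $k\le1$ for all $\alpha\in\Pi_s$ and $k\le0$ for all $\alpha\in\widehat\Pi_l$.
   Formalization: The space V is ℚ^n, with an inner product that takes rational values, rather than a real Euclidean space. -}

module Defs where

open import Data.Nat as ℕ using (ℕ; zero; suc)
open import Data.Integer as ℤ using (ℤ)
open import Data.Rational as ℚ using (ℚ; 0ℚ; 1ℚ; _+_; _*_; -_; _-_; _≤_; _<_; _≟_)
open import Data.Rational.Base using (≢-nonZero; 1/_)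
open import Data.Fin using (Fin; zero; suc)
open import Data.Vec using (Vec; zipWith; map; replicate; lookup)
open import Data.List using (List; []; _∷_)
open import Data.List.Membership.Propositional using (_∈_)
open import Data.Product using (Σ; ∃; _×_; _,_)
open import Data.Sum using (_⊎_)
open import Data.Bool using (Bool; true; false)
open import Relation.Nullary using (¬_; yes; no)
open import Relation.Binary.PropositionalEquality using (_≡_; _≢_)

-- Rational vectors: V = ℚ^n (the rational form of the Euclidean space V)
V : ℕ → Set
V n = Vec ℚ n

0v : ∀ {n} → V n
0v = replicate _ 0ℚ

infixl 6 _+v_ _-v_
_+v_ : ∀ {n} → V n → V n → V n
_+v_ = zipWith _+_

negv : ∀ {n} → V n → V n
negv = map (λ q → - q)

_-v_ : ∀ {n} → V n → V n → V n
x -v y = x +v negv y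

infixl 7 _·v_
_·v_ : ∀ {n} → ℚ → V n → V n
c ·v x = map (c *_) x

sumFin : ∀ {m} → (Fin m → ℚ) → ℚ
sumFin {zero}  f = 0ℚ
sumFin {suc m} f = f zero + sumFin (λ i → f (suc i))

sumVFin : ∀ {m n} → (Fin m → V n) → V n
sumVFin {zero}  f = 0v
sumVFin {suc m} f = f zero +v sumVFin (λ i → f (suc i))

lincomb : ∀ {p n} → (Fin p → ℚ) → (Fin p → V n) → V n
lincomb c v = sumVFin (λ i → c i ·v v i)

lincombL : ∀ {n} → List ℚ → List (V n) → V n
lincombL (c ∷ cs) (x ∷ xs) = c ·v x +v lincombL cs xs
lincombL _ _ = 0v

form : ∀ {n} → (Fin n → Fin n → ℚ) → V n → V n → ℚ
form G x y = sumFin (λ i → sumFin (λ j → lookup x i * (G i j * lookup y j)))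

-- total inverse on ℚ (1/0 := 0; only used at nonzero arguments)
inv : ℚ → ℚ
inv q with q ≟ 0ℚ
... | yes _ = 0ℚ
... | no q≢0 = 1/_ q {{≢-nonZero q≢0}}

ℕ→ℚ : ℕ → ℚ
ℕ→ℚ k = ℚ._/_ (ℤ.+ k) 1

ℤ→ℚ : ℤ → ℚ
ℤ→ℚ k = ℚ._/_ k 1

record RootSystem : Set where
  field
    n   : ℕ
    G   : Fin n → Fin n → ℚ
    G-sym    : ∀ i j → G i j ≡ G j i
    G-posdef : ∀ (x : V n) → x ≢ 0v → 0ℚ < form G x x
    Δ   : List (V n)

  ⟨_,_⟩ : V n → V n → ℚ
  ⟨ x , y ⟩ = form G x y

  coroot : V n → V n
  coroot μ = (ℕ→ℚ 2 * inv ⟨ μ , μ ⟩) ·v μ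

  refl : V n → V n → V n
  refl α x = x -v ⟨ x , coroot α ⟩ ·v α

  field
    spans        : ∀ (x : V n) → ∃ λ (cs : List ℚ) → x ≡ lincombL cs Δ
    nonzero      : ∀ {α} → α ∈ Δ → α ≢ 0v
    refl-closed  : ∀ {α β} → α ∈ Δ → β ∈ Δ → refl α β ∈ Δ
    crystallographic : ∀ {α β} → α ∈ Δ → β ∈ Δ → ∃ λ (m : ℤ) → ⟨ β , coroot α ⟩ ≡ ℤ→ℚ m
    reduced      : ∀ {α} (c : ℚ) → α ∈ Δ → c ·v α ∈ Δ → (c ≡ 1ℚ) ⊎ (c ≡ - 1ℚ)
    irreducible  : ∀ (P : V n → Bool) →
                   (∀ {α β} → α ∈ Δ → β ∈ Δ → P α ≡ true → P β ≡ false → ⟨ α , β ⟩ ≡ 0ℚ) →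
                   (∀ {α} → α ∈ Δ → P α ≡ true) ⊎ (∀ {α} → α ∈ Δ → P α ≡ false)
    twoLengths   : ∃ λ α → ∃ λ β → α ∈ Δ × β ∈ Δ × ⟨ α , α ⟩ ≢ ⟨ β , β ⟩ ×
                   (∀ {γ} → γ ∈ Δ → (⟨ γ , γ ⟩ ≡ ⟨ α , α ⟩) ⊎ (⟨ γ , γ ⟩ ≡ ⟨ β , β ⟩))
    p            : ℕ
    simple       : Fin p → V n
    simple-in    : ∀ i → simple i ∈ Δ
    simple-indep : ∀ (c : Fin p → ℚ) → lincomb c simple ≡ 0v → ∀ i → c i ≡ 0ℚ
    base         : ∀ {β} → β ∈ Δ → ∃ λ (c : Fin p → ℕ) →
                   (β ≡ lincomb (λ i → ℕ→ℚ (c i)) simple) ⊎ (negv β ≡ lincomb (λ i → ℕ→ℚ (c i)) simple)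
    θ            : V n
    θ-in         : θ ∈ Δ
    θ-highest    : ∀ {β} → β ∈ Δ → ∃ λ (c : Fin p → ℕ) → θ -v β ≡ lincomb (λ i → ℕ→ℚ (c i)) simple

module _ (R : RootSystem) where
  open RootSystem R

  Positive : V n → Set
  Positive β = β ∈ Δ × ∃ λ (c : Fin p → ℕ) → β ≡ lincomb (λ i → ℕ→ℚ (c i)) simple

  IsShort : V n → Set
  IsShort α = ∃ λ β → β ∈ Δ × ⟨ α , α ⟩ < ⟨ β , β ⟩

  IsLong : V n → Set
  IsLong α = ∀ {β} → β ∈ Δ → ⟨ β , β ⟩ ≤ ⟨ α , α ⟩

  corootLattice : (Fin p → ℤ) → V n
  corootLattice k = lincomb (λ i → ℤ→ℚ (k i)) (λ i → coroot (simple i))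

  InQ∨ : V n → Set
  InQ∨ x = ∃ λ (k : Fin p → ℤ) → x ≡ corootLattice k

  InDmax : V n → Set
  InDmax x = (∀ i → IsShort (simple i) → ⟨ x , simple i ⟩ ≤ 1ℚ)
           × (∀ i → IsLong (simple i) → ⟨ x , simple i ⟩ ≤ 0ℚ)
           × (1ℚ ≤ ⟨ x , θ ⟩)

  WordW : Set
  WordW = List (Σ (V n) (λ α → α ∈ Δ))

  actW : WordW → V n → V n
  actW [] x = x
  actW ((α , _) ∷ ws) x = refl α (actW ws x)

  record Ŵ : Set where
    constructor _·t_
    field
      v : WordW
      r : Fin p → ℤ

  -- elements μ + kδ of V ⊕ ℚδ, encoded as pairs (μ , k)
  Vδ : Set
  Vδ = V n × ℚ

  -- t_r(x) = x - (x,r)δ, and v fixes δ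
  actŴ : Ŵ → Vδ → Vδ
  actŴ (v ·t r) (μ , k) = actW v μ , (k - ⟨ μ , corootLattice r ⟩)

  _≈Ŵ_ : Ŵ → Ŵ → Set
  w ≈Ŵ w' = ∀ x → actŴ w x ≡ actŴ w' x

  PosAffRoot : Vδ → Set
  PosAffRoot (μ , k) = μ ∈ Δ × ((k ≡ 0ℚ × Positive μ) ⊎ ∃ λ (m : ℕ) → k ≡ ℕ→ℚ (suc m))

  Dominant : Ŵ → Set
  Dominant w = ∀ i → PosAffRoot (actŴ w (simple i , 0ℚ))

  -- s-maximal: dominant, and writing w⁻¹(α) = μ + kδ,
  -- k ≤ 1 for α ∈ Π_s and k ≤ 0 for α ∈ Π_l ∪ {α₀ = δ - θ}
  SMaximal : Ŵ → Set
  SMaximal w = Dominant w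
             × (∀ i → IsShort (simple i) → ∀ μ k → actŴ w (μ , k) ≡ (simple i , 0ℚ) → k ≤ 1ℚ)
             × (∀ i → IsLong (simple i) → ∀ μ k → actŴ w (μ , k) ≡ (simple i , 0ℚ) → k ≤ 0ℚ)
             × (∀ μ k → actŴ w (μ , k) ≡ (negv θ , 1ℚ) → k ≤ 0ℚ)

  vr : Ŵ → V n
  vr (v ·t r) = actW v (corootLattice r)

{-# OPTIONS --safe #-}

-- Write w = v·t_r and x = v(r). Since w⁻¹(τ + cδ) = v⁻¹(τ) + (c + (τ, x))δ, the level bounds
-- defining s-maximality say exactly that x ∈ D^(s)_max, and x ∈ Q∨ because simple reflections
-- preserve Q∨ (the root system is crystallographic) and every reflection is a product of simple
-- ones. Dominance of w says that v maps Π into the cone P_x of vectors γ with (γ, x) < 0, or with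
-- (γ, x) = 0 and γ ∈ Q⁺; as P_x ∩ -P_x = 0, if v and v′ both do so then v′⁻¹v maps Π into Q⁺ and
-- is trivial by the deletion condition, which gives injectivity. For surjectivity, start from
-- v = 1 and replace v by v·sᵢ while some v(αᵢ) ∉ P_x: the number of positive roots β with
-- v(β) ∉ P_x drops, so this stops at a v for which v·t_{v⁻¹(x)} is dominant and maps to x.

module Submission where

open import Defs
open import Data.Nat as ℕ using (ℕ; zero; suc)
import Data.Nat.Properties as ℕP
open import Data.Nat.Induction using (<-wellFounded)
open import Data.Integer as ℤ using (ℤ; -[1+_])
import Data.Integer.Properties as ℤP
open import Data.Rational as ℚ using (ℚ; 0ℚ; 1ℚ; _+_; _*_; -_; _-_; _≤_; _<_; _>_; _≟_)
import Data.Rational.Properties as ℚP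
open import Data.Rational.Base using (≢-nonZero)
open import Data.Rational.Literals using (fromℤ)
open import Data.Rational.Solver using (module +-*-Solver)
open import Data.Fin using (Fin; zero; suc)
import Data.Fin.Properties as FinP
open import Data.Vec using (lookup; tabulate)
import Data.Vec.Properties as VecP
open import Data.List as List
  using (List; []; _∷_; _++_; reverse; [_]; length; _∷ʳ_; InitLast; initLast; _∷ʳ′_; filter; deduplicate)
import Data.List.Properties as LP
open import Data.List.Membership.Propositional using (_∈_; _∉_)
open import Data.List.Membership.Propositional.Properties
  using (∈-filter⁺; ∈-filter⁻; ∈-deduplicate⁺; ∈-deduplicate⁻; ∈-map⁻)
open import Data.List.Relation.Unary.Any as Any using (here; there; _─_)
open import Data.List.Relation.Unary.All as All using ()
open import Data.List.Relation.Unary.All.Properties using (¬Any⇒All¬)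
open import Data.List.Relation.Unary.AllPairs using (_∷_)
open import Data.List.Relation.Unary.Unique.Propositional using (Unique)
import Data.List.Relation.Unary.Unique.Propositional.Properties as UniqueP
import Data.List.Relation.Unary.Unique.DecPropositional.Properties as UniqueDecP
open import Data.Product using (∃; ∃₂; _×_; _,_; proj₁; proj₂)
open import Data.Sum using (_⊎_; inj₁; inj₂)
open import Data.Empty using (⊥-elim)
open import Function using (_∘_)
open import Function.Bundles using (_⇔_; mk⇔; Equivalence)
open import Induction.WellFounded using (Acc; acc)
open import Relation.Nullary using (Dec; yes; no; ¬_)
open import Relation.Nullary.Decidable using (¬?)
import Relation.Nullary.Decidable as Dec
open import Relation.Binary.Definitions using (DecidableEquality; Tri; tri<; tri≈; tri>)
open import Relation.Binary.PropositionalEquality hiding ([_])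
open import Algebra.Bundles using (CommutativeRing)
open import Algebra.Properties.Semiring.Sum (CommutativeRing.semiring ℚP.+-*-commutativeRing)
  using (sum-syntax; sum-cong-≗; ∑-distrib-+; ∑-comm; *-distribˡ-sum)
open import Algebra.Properties.Semiring.Sum ℕP.+-*-semiring using () renaming (sum to ∑ℕ)
open import Algebra.Properties.Semiring.Sum ℤP.+-*-semiring using () renaming (sum to ∑ℤ)
open import Algebra.Properties.Ring ℚP.+-*-ring using (-1*x≈-x)
open import Algebra.Properties.Group ℚP.+-0-group using ()
  renaming (⁻¹-involutive to -‿involutive; x∙y⁻¹≈ε⇒x≈y to x-y≡0⇒x≡y)

open +-*-Solver

ℤ→ℚ≡fromℤ : ∀ z → ℤ→ℚ z ≡ fromℤ z
ℤ→ℚ≡fromℤ z = ℚP.↥p/↧p≡p (fromℤ z)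

-- The middle step is ℚ addition computing on two fractions with denominator 1.
ℤ→ℚ-homo-+ : ∀ a b → ℤ→ℚ (a ℤ.+ b) ≡ ℤ→ℚ a + ℤ→ℚ b
ℤ→ℚ-homo-+ a b = begin
  ℤ→ℚ (a ℤ.+ b)                          ≡⟨ cong₂ (λ x y → ℤ→ℚ (x ℤ.+ y)) (ℤP.*-identityʳ a) (ℤP.*-identityʳ b) ⟨
  ℤ→ℚ (a ℤ.* ℤ.+ 1 ℤ.+ b ℤ.* ℤ.+ 1)      ≡⟨⟩
  fromℤ a + fromℤ b                      ≡⟨ cong₂ _+_ (ℤ→ℚ≡fromℤ a) (ℤ→ℚ≡fromℤ b) ⟨
  ℤ→ℚ a + ℤ→ℚ b                          ∎
  where open ≡-Reasoning

ℤ→ℚ-homo-* : ∀ a b → ℤ→ℚ (a ℤ.* b) ≡ ℤ→ℚ a * ℤ→ℚ b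
ℤ→ℚ-homo-* a b = sym (cong₂ _*_ (ℤ→ℚ≡fromℤ a) (ℤ→ℚ≡fromℤ b))

ℤ→ℚ-homo‿- : ∀ a → ℤ→ℚ (ℤ.- a) ≡ - ℤ→ℚ a
ℤ→ℚ-homo‿- (ℤ.+ zero)  = refl
ℤ→ℚ-homo‿- (ℤ.+ suc n) = refl
ℤ→ℚ-homo‿- -[1+ n ]    = sym (-‿involutive (ℤ→ℚ (ℤ.+ suc n)))

ℤ→ℚ-cancel-< : ∀ {a b} → ℤ→ℚ a < ℤ→ℚ b → a ℤ.< b
ℤ→ℚ-cancel-< {a} {b} a<b with subst₂ _<_ (ℤ→ℚ≡fromℤ a) (ℤ→ℚ≡fromℤ b) a<b
... | ℚ.*<* a*1<b*1 = subst₂ ℤ._<_ (ℤP.*-identityʳ a) (ℤP.*-identityʳ b) a*1<b*1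

ℕ→ℚ-cancel-< : ∀ {m n} → ℕ→ℚ m < ℕ→ℚ n → m ℕ.< n
ℕ→ℚ-cancel-< m<n = ℤP.drop‿+<+ (ℤ→ℚ-cancel-< m<n)

ℕ→ℚ-nonNeg : ∀ n → 0ℚ ≤ ℕ→ℚ n
ℕ→ℚ-nonNeg n = ℚP.nonNegative⁻¹ _ {{ℚP.normalize-nonNeg n 1}}

ℕ→ℚ-pos : ∀ n → 0ℚ < ℕ→ℚ (suc n)
ℕ→ℚ-pos n = ℚP.positive⁻¹ _ {{ℚP.normalize-pos (suc n) 1}}

0-q≡0⇒q≡0 : ∀ {q} → 0ℚ - q ≡ 0ℚ → q ≡ 0ℚ
0-q≡0⇒q≡0 {q} 0-q≡0 = sym (x-y≡0⇒x≡y 0ℚ q 0-q≡0)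

0-q≡1+m⇒q<0 : ∀ {q m} → 0ℚ - q ≡ ℕ→ℚ (suc m) → q < 0ℚ
0-q≡1+m⇒q<0 {q} {m} 0-q≡1+m = subst₂ _<_ (-‿involutive q) refl
  (ℚP.neg-antimono-< (subst (0ℚ <_) (trans (sym 0-q≡1+m) (ℚP.+-identityˡ (- q))) (ℕ→ℚ-pos m)))

ℤ→ℚ<0⇒0-ℤ→ℚ≡1+m : ∀ z → ℤ→ℚ z < 0ℚ → ∃ λ m → 0ℚ - ℤ→ℚ z ≡ ℕ→ℚ (suc m)
ℤ→ℚ<0⇒0-ℤ→ℚ≡1+m (ℤ.+ k)   k<0 = ⊥-elim (ℚP.<-irrefl refl (ℚP.<-≤-trans k<0 (ℕ→ℚ-nonNeg k)))
ℤ→ℚ<0⇒0-ℤ→ℚ≡1+m -[1+ m ] _   = m , trans (ℚP.+-identityˡ _) (-‿involutive (ℕ→ℚ (suc m)))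

nonNeg+nonNeg≡0⇒≡0 : ∀ {a b} → 0ℚ ≤ a → 0ℚ ≤ b → a + b ≡ 0ℚ → a ≡ 0ℚ
nonNeg+nonNeg≡0⇒≡0 {a} {b} 0≤a 0≤b a+b≡0 = ℚP.≤-antisym a≤0 0≤a
  where
  a≤0 : a ≤ 0ℚ
  a≤0 = subst (a ≤_) a+b≡0 (subst (_≤ a + b) (ℚP.+-identityʳ a) (ℚP.+-monoʳ-≤ a 0≤b))

0<c*t⇒0<t : ∀ {c t} → 0ℚ ≤ c → 0ℚ < c * t → 0ℚ < t
0<c*t⇒0<t {c} {t} 0≤c 0<ct =
  ℚP.*-cancelˡ-<-nonNeg c {{ℚ.nonNegative 0≤c}} (subst (_< c * t) (sym (ℚP.*-zeroʳ c)) 0<ct)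

p-q≤0⇔p≤q : ∀ p q → p - q ≤ 0ℚ ⇔ p ≤ q
p-q≤0⇔p≤q p q = mk⇔
  (λ p-q≤0 → subst₂ _≤_ (solve 2 (λ p q → (p :- q) :+ q := p) refl p q) (ℚP.+-identityˡ q) (ℚP.+-monoˡ-≤ q p-q≤0))
  (λ p≤q → subst (p - q ≤_) (ℚP.+-inverseʳ q) (ℚP.+-monoˡ-≤ (- q) p≤q))

inv-inverseʳ : ∀ q → q ≢ 0ℚ → q * inv q ≡ 1ℚ
inv-inverseʳ q q≢0 with q ≟ 0ℚ
... | yes q≡0 = ⊥-elim (q≢0 q≡0)
... | no  q≢0 = ℚP.*-inverseʳ q {{≢-nonZero q≢0}}

inv-pos : ∀ q → 0ℚ < q → 0ℚ < inv q
inv-pos q 0<q with q ≟ 0ℚ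
... | yes q≡0 = ⊥-elim (ℚP.<-irrefl (sym q≡0) 0<q)
... | no  q≢0 = ℚP.positive⁻¹ _ {{ℚP.1/pos⇒pos q {{ℚ.positive 0<q}}}}

sumFin≡∑ : ∀ {m} (f : Fin m → ℚ) → sumFin f ≡ ∑[ i < m ] f i
sumFin≡∑ {zero}  f = refl
sumFin≡∑ {suc m} f = cong (f zero +_) (sumFin≡∑ (f ∘ suc))

sumFin-cong : ∀ {m} {f g : Fin m → ℚ} → (∀ i → f i ≡ g i) → sumFin f ≡ sumFin g
sumFin-cong {zero}  f≗g = refl
sumFin-cong {suc m} f≗g = cong₂ _+_ (f≗g zero) (sumFin-cong (f≗g ∘ suc))

sumFin-distrib-+ : ∀ {m} (f g : Fin m → ℚ) → sumFin (λ i → f i + g i) ≡ sumFin f + sumFin g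
sumFin-distrib-+ f g rewrite sumFin≡∑ (λ i → f i + g i) | sumFin≡∑ f | sumFin≡∑ g = ∑-distrib-+ f g

*-distribˡ-sumFin : ∀ {m} c (f : Fin m → ℚ) → c * sumFin f ≡ sumFin (λ i → c * f i)
*-distribˡ-sumFin c f rewrite sumFin≡∑ f | sumFin≡∑ (λ i → c * f i) = *-distribˡ-sum c f

sumFin-linear : ∀ {m} a b (f g : Fin m → ℚ) →
                sumFin (λ i → a * f i + b * g i) ≡ a * sumFin f + b * sumFin g
sumFin-linear a b f g = begin
  sumFin (λ i → a * f i + b * g i)                 ≡⟨ sumFin-distrib-+ (λ i → a * f i) (λ i → b * g i) ⟩
  sumFin (λ i → a * f i) + sumFin (λ i → b * g i)  ≡⟨ cong₂ _+_ (*-distribˡ-sumFin a f) (*-distribˡ-sumFin b g) ⟨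
  a * sumFin f + b * sumFin g                      ∎
  where open ≡-Reasoning

sumFin-comm : ∀ {m k} (f : Fin m → Fin k → ℚ) →
              sumFin (λ i → sumFin (f i)) ≡ sumFin (λ j → sumFin (λ i → f i j))
sumFin-comm {m} {k} f = begin
  sumFin (λ i → sumFin (f i))                ≡⟨ sumFin≡∑ (λ i → sumFin (f i)) ⟩
  ∑[ i < m ] sumFin (f i)                    ≡⟨ sum-cong-≗ (λ i → sumFin≡∑ (f i)) ⟩
  ∑[ i < m ] ∑[ j < k ] f i j                ≡⟨ ∑-comm f ⟩
  ∑[ j < k ] ∑[ i < m ] f i j                ≡⟨ sum-cong-≗ (λ j → sumFin≡∑ (λ i → f i j)) ⟨
  ∑[ j < k ] sumFin (λ i → f i j)            ≡⟨ sumFin≡∑ (λ j → sumFin (λ i → f i j)) ⟨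
  sumFin (λ j → sumFin (λ i → f i j))        ∎
  where open ≡-Reasoning

positive-sumFin⇒positive-term : ∀ {m} (f : Fin m → ℚ) → 0ℚ < sumFin f → ∃ λ k → 0ℚ < f k
positive-sumFin⇒positive-term {zero}  f 0<0 = ⊥-elim (ℚP.<-irrefl refl 0<0)
positive-sumFin⇒positive-term {suc m} f 0<Σ with 0ℚ ℚP.<? f zero
... | yes 0<f₀ = zero , 0<f₀
... | no  0≮f₀ with positive-sumFin⇒positive-term (f ∘ suc) (ℚP.≰⇒> λ Σ≤0 → ℚP.<-irrefl refl
                     (ℚP.<-≤-trans 0<Σ (ℚP.+-mono-≤ (ℚP.≮⇒≥ 0≮f₀) Σ≤0)))
...   | k , 0<fk = suc k , 0<fk

ℕ→ℚ-homo-∑ : ∀ {m} (c : Fin m → ℕ) → ℕ→ℚ (∑ℕ c) ≡ sumFin (λ i → ℕ→ℚ (c i))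
ℕ→ℚ-homo-∑ {zero}  c = refl
ℕ→ℚ-homo-∑ {suc m} c = trans (ℤ→ℚ-homo-+ (ℤ.+ c zero) (ℤ.+ ∑ℕ (c ∘ suc))) (cong (ℕ→ℚ (c zero) +_) (ℕ→ℚ-homo-∑ (c ∘ suc)))

ℤ→ℚ-homo-∑ : ∀ {m} (c : Fin m → ℤ) → ℤ→ℚ (∑ℤ c) ≡ sumFin (λ i → ℤ→ℚ (c i))
ℤ→ℚ-homo-∑ {zero}  c = refl
ℤ→ℚ-homo-∑ {suc m} c = trans (ℤ→ℚ-homo-+ (c zero) (∑ℤ (c ∘ suc))) (cong (ℤ→ℚ (c zero) +_) (ℤ→ℚ-homo-∑ (c ∘ suc)))

δ : ∀ {m} → Fin m → Fin m → ℕ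
δ zero    zero    = 1
δ zero    (suc l) = 0
δ (suc k) zero    = 0
δ (suc k) (suc l) = δ k l

δ-diag : ∀ {m} (k : Fin m) → δ k k ≡ 1
δ-diag zero    = refl
δ-diag (suc k) = δ-diag k

δ-≢ : ∀ {m} {k l : Fin m} → k ≢ l → δ k l ≡ 0
δ-≢ {k = zero}  {zero}  k≢l = ⊥-elim (k≢l refl)
δ-≢ {k = zero}  {suc l} k≢l = refl
δ-≢ {k = suc k} {zero}  k≢l = refl
δ-≢ {k = suc k} {suc l} k≢l = δ-≢ (k≢l ∘ cong suc)

sumFin-δ : ∀ {m} (k : Fin m) (f : Fin m → ℚ) → sumFin (λ l → ℕ→ℚ (δ k l) * f l) ≡ f k
sumFin-δ zero f = begin
  1ℚ * f zero + sumFin (λ l → 0ℚ * f (suc l))   ≡⟨ cong₂ _+_ (ℚP.*-identityˡ (f zero)) (sym (*-distribˡ-sumFin 0ℚ (f ∘ suc))) ⟩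
  f zero + 0ℚ * sumFin (f ∘ suc)                 ≡⟨ cong (f zero +_) (ℚP.*-zeroˡ (sumFin (f ∘ suc))) ⟩
  f zero + 0ℚ                                    ≡⟨ ℚP.+-identityʳ (f zero) ⟩
  f zero                                         ∎
  where open ≡-Reasoning
sumFin-δ (suc k) f = begin
  0ℚ * f zero + sumFin (λ l → ℕ→ℚ (δ k l) * f (suc l))   ≡⟨ cong₂ _+_ (ℚP.*-zeroˡ (f zero)) (sumFin-δ k (f ∘ suc)) ⟩
  0ℚ + f (suc k)                                          ≡⟨ ℚP.+-identityˡ (f (suc k)) ⟩
  f (suc k)                                               ∎
  where open ≡-Reasoning

≗⇒≡ : ∀ {m} (x y : V m) → (∀ j → lookup x j ≡ lookup y j) → x ≡ y
≗⇒≡ x y x≗y = begin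
  x                  ≡⟨ VecP.tabulate∘lookup x ⟨
  tabulate (lookup x) ≡⟨ VecP.tabulate-cong x≗y ⟩
  tabulate (lookup y) ≡⟨ VecP.tabulate∘lookup y ⟩
  y                  ∎
  where open ≡-Reasoning

module _ {m : ℕ} (G : Fin m → Fin m → ℚ) where

  form-linearʳ : ∀ x {y u w : V m} a b → (∀ j → lookup y j ≡ a * lookup u j + b * lookup w j) →
                 form G x y ≡ a * form G x u + b * form G x w
  form-linearʳ x {y} {u} {w} a b y≡au+bw = begin
    sumFin (λ i → sumFin (λ j → X i j y))
      ≡⟨ sumFin-cong (λ i → sumFin-cong (λ j → expand i j)) ⟩
    sumFin (λ i → sumFin (λ j → a * X i j u + b * X i j w))
      ≡⟨ sumFin-cong (λ i → sumFin-linear a b (λ j → X i j u) (λ j → X i j w)) ⟩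
    sumFin (λ i → a * sumFin (λ j → X i j u) + b * sumFin (λ j → X i j w))
      ≡⟨ sumFin-linear a b (λ i → sumFin (λ j → X i j u)) (λ i → sumFin (λ j → X i j w)) ⟩
    a * form G x u + b * form G x w ∎
    where
    open ≡-Reasoning
    X : Fin m → Fin m → V m → ℚ
    X i j z = lookup x i * (G i j * lookup z j)
    expand : ∀ i j → X i j y ≡ a * X i j u + b * X i j w
    expand i j rewrite y≡au+bw j =
      solve 6 (λ xi g a u b w → xi :* (g :* (a :* u :+ b :* w)) := a :* (xi :* (g :* u)) :+ b :* (xi :* (g :* w)))
            refl (lookup x i) (G i j) a (lookup u j) b (lookup w j)

  form-sym : (∀ i j → G i j ≡ G j i) → ∀ x y → form G x y ≡ form G y x
  form-sym G-sym x y = trans (sumFin-comm (λ i j → lookup x i * (G i j * lookup y j)))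
    (sumFin-cong λ j → sumFin-cong λ i → begin
      lookup x i * (G i j * lookup y j) ≡⟨ cong (λ g → lookup x i * (g * lookup y j)) (G-sym i j) ⟩
      lookup x i * (G j i * lookup y j) ≡⟨ solve 3 (λ a g b → a :* (g :* b) := b :* (g :* a)) refl (lookup x i) (G j i) (lookup y j) ⟩
      lookup y j * (G j i * lookup x i) ∎)
    where open ≡-Reasoning

module _ {A : Set} where

  ∈-─ : ∀ {x z : A} {ys} (x∈ys : x ∈ ys) → z ∈ ys → z ≢ x → z ∈ (ys ─ x∈ys)
  ∈-─ (here refl)  (here refl)  z≢x = ⊥-elim (z≢x refl)
  ∈-─ (here refl)  (there z∈ys) _   = z∈ys
  ∈-─ (there x∈ys) (here refl)  _   = here refl
  ∈-─ (there x∈ys) (there z∈ys) z≢x = there (∈-─ x∈ys z∈ys z≢x)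

  Unique-⊆⇒length-≤ : ∀ {xs ys : List A} → Unique xs → (∀ {z} → z ∈ xs → z ∈ ys) → length xs ℕ.≤ length ys
  Unique-⊆⇒length-≤ {[]}     _               _     = ℕ.z≤n
  Unique-⊆⇒length-≤ {x ∷ xs} {ys} (x∉xs ∷ xs!) xs⊆ys =
    subst (suc (length xs) ℕ.≤_) (sym (LP.length-removeAt′ ys (Any.index x∈ys)))
      (ℕ.s≤s (Unique-⊆⇒length-≤ xs! λ z∈xs → ∈-─ x∈ys (xs⊆ys (there z∈xs)) (≢-sym (All.lookup x∉xs z∈xs))))
    where
    x∈ys = xs⊆ys (here refl)

  Unique-⊂⇒length-< : ∀ {xs ys : List A} {a} → Unique xs → (∀ {z} → z ∈ xs → z ∈ ys) →
                      a ∈ ys → a ∉ xs → length xs ℕ.< length ys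
  Unique-⊂⇒length-< {xs} xs! xs⊆ys a∈ys a∉xs = Unique-⊆⇒length-≤ (¬Any⇒All¬ xs a∉xs ∷ xs!) λ where
    (here refl)  → a∈ys
    (there z∈xs) → xs⊆ys z∈xs

module _ (R : RootSystem) where
  open RootSystem R renaming (refl to s)

  ⟨⟩-sym : ∀ x y → ⟨ x , y ⟩ ≡ ⟨ y , x ⟩
  ⟨⟩-sym = form-sym G G-sym

  ⟨⟩-+ʳ : ∀ μ x y → ⟨ μ , x +v y ⟩ ≡ ⟨ μ , x ⟩ + ⟨ μ , y ⟩
  ⟨⟩-+ʳ μ x y = trans
    (form-linearʳ G μ {x +v y} {x} {y} 1ℚ 1ℚ λ j → trans (VecP.lookup-zipWith _+_ j x y)
      (cong₂ _+_ (sym (ℚP.*-identityˡ (lookup x j))) (sym (ℚP.*-identityˡ (lookup y j)))))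
    (cong₂ _+_ (ℚP.*-identityˡ ⟨ μ , x ⟩) (ℚP.*-identityˡ ⟨ μ , y ⟩))

  ⟨⟩-·ʳ : ∀ μ c x → ⟨ μ , c ·v x ⟩ ≡ c * ⟨ μ , x ⟩
  ⟨⟩-·ʳ μ c x = trans
    (form-linearʳ G μ {c ·v x} {x} {x} c 0ℚ λ j → trans (VecP.lookup-map j (c *_) x)
      (sym (trans (cong (c * lookup x j +_) (ℚP.*-zeroˡ (lookup x j))) (ℚP.+-identityʳ (c * lookup x j)))))
    (trans (cong (c * ⟨ μ , x ⟩ +_) (ℚP.*-zeroˡ ⟨ μ , x ⟩)) (ℚP.+-identityʳ (c * ⟨ μ , x ⟩)))

  ⟨⟩-0ʳ : ∀ μ → ⟨ μ , 0v ⟩ ≡ 0ℚ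
  ⟨⟩-0ʳ μ = trans (cong ⟨ μ ,_⟩ 0v≡0·0v) (trans (⟨⟩-·ʳ μ 0ℚ 0v) (ℚP.*-zeroˡ ⟨ μ , 0v ⟩))
    where
    0v≡0·0v : 0v ≡ 0ℚ ·v 0v {n}
    0v≡0·0v = ≗⇒≡ 0v (0ℚ ·v 0v) λ j → trans (VecP.lookup-replicate j 0ℚ)
      (sym (trans (VecP.lookup-map j (0ℚ *_) 0v) (ℚP.*-zeroˡ (lookup (0v {n}) j))))

  ⟨⟩-negʳ : ∀ μ x → ⟨ μ , negv x ⟩ ≡ - ⟨ μ , x ⟩
  ⟨⟩-negʳ μ x = begin
    ⟨ μ , negv x ⟩          ≡⟨ cong ⟨ μ ,_⟩ (≗⇒≡ (negv x) (- 1ℚ ·v x) λ j → trans (VecP.lookup-map j -_ x)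
                               (sym (trans (VecP.lookup-map j (- 1ℚ *_) x) (-1*x≈-x (lookup x j))))) ⟩
    ⟨ μ , - 1ℚ ·v x ⟩       ≡⟨ ⟨⟩-·ʳ μ (- 1ℚ) x ⟩
    - 1ℚ * ⟨ μ , x ⟩        ≡⟨ -1*x≈-x ⟨ μ , x ⟩ ⟩
    - ⟨ μ , x ⟩             ∎
    where open ≡-Reasoning

  ⟨⟩--ʳ : ∀ μ x y → ⟨ μ , x -v y ⟩ ≡ ⟨ μ , x ⟩ - ⟨ μ , y ⟩
  ⟨⟩--ʳ μ x y = trans (⟨⟩-+ʳ μ x (negv y)) (cong (⟨ μ , x ⟩ +_) (⟨⟩-negʳ μ y))

  ⟨⟩-+ˡ : ∀ x y μ → ⟨ x +v y , μ ⟩ ≡ ⟨ x , μ ⟩ + ⟨ y , μ ⟩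
  ⟨⟩-+ˡ x y μ = trans (⟨⟩-sym (x +v y) μ) (trans (⟨⟩-+ʳ μ x y) (cong₂ _+_ (⟨⟩-sym μ x) (⟨⟩-sym μ y)))

  ⟨⟩-·ˡ : ∀ c x μ → ⟨ c ·v x , μ ⟩ ≡ c * ⟨ x , μ ⟩
  ⟨⟩-·ˡ c x μ = trans (⟨⟩-sym (c ·v x) μ) (trans (⟨⟩-·ʳ μ c x) (cong (c *_) (⟨⟩-sym μ x)))

  ⟨⟩-negˡ : ∀ x μ → ⟨ negv x , μ ⟩ ≡ - ⟨ x , μ ⟩
  ⟨⟩-negˡ x μ = trans (⟨⟩-sym (negv x) μ) (trans (⟨⟩-negʳ μ x) (cong -_ (⟨⟩-sym μ x)))

  ⟨⟩-0ˡ : ∀ μ → ⟨ 0v , μ ⟩ ≡ 0ℚ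
  ⟨⟩-0ˡ μ = trans (⟨⟩-sym 0v μ) (⟨⟩-0ʳ μ)

  pairing-ext : ∀ {x y} → (∀ μ → ⟨ μ , x ⟩ ≡ ⟨ μ , y ⟩) → x ≡ y
  pairing-ext {x} {y} x≈y with VecP.≡-dec _≟_ (x -v y) 0v
  ... | yes x-y≡0 = ≗⇒≡ x y λ j → x-y≡0⇒x≡y (lookup x j) (lookup y j) (begin
        lookup x j + - lookup y j        ≡⟨ cong (lookup x j +_) (VecP.lookup-map j -_ y) ⟨
        lookup x j + lookup (negv y) j   ≡⟨ VecP.lookup-zipWith _+_ j x (negv y) ⟨
        lookup (x -v y) j                ≡⟨ cong (λ z → lookup z j) x-y≡0 ⟩
        lookup (0v {n}) j                ≡⟨ VecP.lookup-replicate j 0ℚ ⟩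
        0ℚ                               ∎)
    where open ≡-Reasoning
  ... | no  x-y≢0 = ⊥-elim (ℚP.<-irrefl (sym ‖x-y‖≡0) (G-posdef (x -v y) x-y≢0))
    where
    ‖x-y‖≡0 : ⟨ x -v y , x -v y ⟩ ≡ 0ℚ
    ‖x-y‖≡0 = trans (⟨⟩--ʳ (x -v y) x y)
                (trans (cong (_- ⟨ x -v y , y ⟩) (x≈y (x -v y))) (ℚP.+-inverseʳ ⟨ x -v y , y ⟩))

  negv-involutive : ∀ x → negv (negv x) ≡ x
  negv-involutive x = pairing-ext λ μ →
    trans (⟨⟩-negʳ μ (negv x)) (trans (cong -_ (⟨⟩-negʳ μ x)) (-‿involutive ⟨ μ , x ⟩))

  +v-inverseʳ : ∀ x → x +v negv x ≡ 0v
  +v-inverseʳ x = pairing-ext λ μ → begin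
    ⟨ μ , x +v negv x ⟩       ≡⟨ ⟨⟩-+ʳ μ x (negv x) ⟩
    ⟨ μ , x ⟩ + ⟨ μ , negv x ⟩ ≡⟨ cong (⟨ μ , x ⟩ +_) (⟨⟩-negʳ μ x) ⟩
    ⟨ μ , x ⟩ + - ⟨ μ , x ⟩    ≡⟨ ℚP.+-inverseʳ ⟨ μ , x ⟩ ⟩
    0ℚ                        ≡⟨ ⟨⟩-0ʳ μ ⟨
    ⟨ μ , 0v ⟩                ∎
    where open ≡-Reasoning

  negv-·v : ∀ c x → negv (c ·v x) ≡ (- c) ·v x
  negv-·v c x = pairing-ext λ μ → begin
    ⟨ μ , negv (c ·v x) ⟩   ≡⟨ trans (⟨⟩-negʳ μ (c ·v x)) (cong -_ (⟨⟩-·ʳ μ c x)) ⟩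
    - (c * ⟨ μ , x ⟩)       ≡⟨ ℚP.neg-distribˡ-* c ⟨ μ , x ⟩ ⟩
    - c * ⟨ μ , x ⟩         ≡⟨ ⟨⟩-·ʳ μ (- c) x ⟨
    ⟨ μ , (- c) ·v x ⟩      ∎
    where open ≡-Reasoning

  ·v-identityˡ : ∀ x → 1ℚ ·v x ≡ x
  ·v-identityˡ x = pairing-ext λ μ → trans (⟨⟩-·ʳ μ 1ℚ x) (ℚP.*-identityˡ ⟨ μ , x ⟩)

  0·v≡0v : ∀ γ → 0ℚ ·v γ ≡ 0v
  0·v≡0v γ = pairing-ext λ μ → trans (⟨⟩-·ʳ μ 0ℚ γ) (trans (ℚP.*-zeroˡ ⟨ μ , γ ⟩) (sym (⟨⟩-0ʳ μ)))

  ⟨⟩-sumVFin : ∀ {k} μ (f : Fin k → V n) → ⟨ μ , sumVFin f ⟩ ≡ sumFin (λ i → ⟨ μ , f i ⟩)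
  ⟨⟩-sumVFin {zero}  μ f = ⟨⟩-0ʳ μ
  ⟨⟩-sumVFin {suc k} μ f =
    trans (⟨⟩-+ʳ μ (f zero) (sumVFin (f ∘ suc))) (cong (⟨ μ , f zero ⟩ +_) (⟨⟩-sumVFin μ (f ∘ suc)))

  ⟨⟩-lincomb : ∀ {k} μ (c : Fin k → ℚ) (v : Fin k → V n) →
               ⟨ μ , lincomb c v ⟩ ≡ sumFin (λ i → c i * ⟨ μ , v i ⟩)
  ⟨⟩-lincomb μ c v = trans (⟨⟩-sumVFin μ (λ i → c i ·v v i)) (sumFin-cong λ i → ⟨⟩-·ʳ μ (c i) (v i))

  lincomb-cong : ∀ {k} {a b : Fin k → ℚ} (v : Fin k → V n) → (∀ l → a l ≡ b l) → lincomb a v ≡ lincomb b v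
  lincomb-cong {a = a} {b} v a≗b = pairing-ext λ μ →
    trans (⟨⟩-lincomb μ a v) (trans (sumFin-cong λ l → cong (_* ⟨ μ , v l ⟩) (a≗b l)) (sym (⟨⟩-lincomb μ b v)))

  lincomb-+ : ∀ {k} (a b : Fin k → ℚ) v → lincomb a v +v lincomb b v ≡ lincomb (λ l → a l + b l) v
  lincomb-+ a b v = pairing-ext λ μ → begin
    ⟨ μ , lincomb a v +v lincomb b v ⟩                                  ≡⟨ ⟨⟩-+ʳ μ (lincomb a v) (lincomb b v) ⟩
    ⟨ μ , lincomb a v ⟩ + ⟨ μ , lincomb b v ⟩                           ≡⟨ cong₂ _+_ (⟨⟩-lincomb μ a v) (⟨⟩-lincomb μ b v) ⟩
    sumFin (λ l → a l * ⟨ μ , v l ⟩) + sumFin (λ l → b l * ⟨ μ , v l ⟩) ≡⟨ sumFin-distrib-+ (λ l → a l * ⟨ μ , v l ⟩) (λ l → b l * ⟨ μ , v l ⟩) ⟨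
    sumFin (λ l → a l * ⟨ μ , v l ⟩ + b l * ⟨ μ , v l ⟩)                ≡⟨ sumFin-cong (λ l → ℚP.*-distribʳ-+ ⟨ μ , v l ⟩ (a l) (b l)) ⟨
    sumFin (λ l → (a l + b l) * ⟨ μ , v l ⟩)                            ≡⟨ ⟨⟩-lincomb μ (λ l → a l + b l) v ⟨
    ⟨ μ , lincomb (λ l → a l + b l) v ⟩                                 ∎
    where open ≡-Reasoning

  lincomb-· : ∀ {k} c (a : Fin k → ℚ) v → c ·v lincomb a v ≡ lincomb (λ l → c * a l) v
  lincomb-· c a v = pairing-ext λ μ → begin
    ⟨ μ , c ·v lincomb a v ⟩                  ≡⟨ ⟨⟩-·ʳ μ c (lincomb a v) ⟩
    c * ⟨ μ , lincomb a v ⟩                   ≡⟨ cong (c *_) (⟨⟩-lincomb μ a v) ⟩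
    c * sumFin (λ l → a l * ⟨ μ , v l ⟩)      ≡⟨ *-distribˡ-sumFin c (λ l → a l * ⟨ μ , v l ⟩) ⟩
    sumFin (λ l → c * (a l * ⟨ μ , v l ⟩))    ≡⟨ sumFin-cong (λ l → ℚP.*-assoc c (a l) ⟨ μ , v l ⟩) ⟨
    sumFin (λ l → (c * a l) * ⟨ μ , v l ⟩)    ≡⟨ ⟨⟩-lincomb μ (λ l → c * a l) v ⟨
    ⟨ μ , lincomb (λ l → c * a l) v ⟩         ∎
    where open ≡-Reasoning

  lincomb-δ : ∀ {k} j (v : Fin k → V n) → lincomb (λ l → ℕ→ℚ (δ j l)) v ≡ v j
  lincomb-δ j v = pairing-ext λ μ → trans (⟨⟩-lincomb μ (λ l → ℕ→ℚ (δ j l)) v) (sumFin-δ j (λ l → ⟨ μ , v l ⟩))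

  ·v-as-lincomb : ∀ {k} m j (v : Fin k → V n) → m ·v v j ≡ lincomb (λ l → m * ℕ→ℚ (δ j l)) v
  ·v-as-lincomb m j v = trans (cong (m ·v_) (sym (lincomb-δ j v))) (lincomb-· m _ v)

  lincomb-zero : ∀ {k} (v : Fin k → V n) → lincomb (λ _ → 0ℚ) v ≡ 0v
  lincomb-zero v = pairing-ext λ μ → begin
    ⟨ μ , lincomb (λ _ → 0ℚ) v ⟩        ≡⟨ ⟨⟩-lincomb μ (λ _ → 0ℚ) v ⟩
    sumFin (λ l → 0ℚ * ⟨ μ , v l ⟩)     ≡⟨ *-distribˡ-sumFin 0ℚ (λ l → ⟨ μ , v l ⟩) ⟨
    0ℚ * sumFin (λ l → ⟨ μ , v l ⟩)     ≡⟨ ℚP.*-zeroˡ (sumFin (λ l → ⟨ μ , v l ⟩)) ⟩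
    0ℚ                                  ≡⟨ ⟨⟩-0ʳ μ ⟨
    ⟨ μ , 0v ⟩                          ∎
    where open ≡-Reasoning

  lincomb-single : ∀ {k} (a : Fin k → ℚ) (v : Fin k → V n) j → (∀ l → j ≢ l → a l ≡ 0ℚ) → lincomb a v ≡ a j ·v v j
  lincomb-single a v j aₗ≡0 = trans (lincomb-cong v a≡aⱼδ) (sym (·v-as-lincomb (a j) j v))
    where
    a≡aⱼδ : ∀ l → a l ≡ a j * ℕ→ℚ (δ j l)
    a≡aⱼδ l with j FinP.≟ l
    ... | yes refl = sym (trans (cong (λ t → a j * ℕ→ℚ t) (δ-diag j)) (ℚP.*-identityʳ (a j)))
    ... | no  j≢l  = trans (aₗ≡0 l j≢l) (sym (trans (cong (λ t → a j * ℕ→ℚ t) (δ-≢ j≢l)) (ℚP.*-zeroʳ (a j))))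

  -- Reflections and the Weyl group

  ⟨⟩-coroot : ∀ x α → ⟨ x , coroot α ⟩ ≡ (ℕ→ℚ 2 * inv ⟨ α , α ⟩) * ⟨ x , α ⟩
  ⟨⟩-coroot x α = ⟨⟩-·ʳ x (ℕ→ℚ 2 * inv ⟨ α , α ⟩) α

  ⟨root,root⟩-pos : ∀ {α} → α ∈ Δ → 0ℚ < ⟨ α , α ⟩
  ⟨root,root⟩-pos α∈Δ = G-posdef _ (nonzero α∈Δ)

  ⟨root,coroot⟩≡2 : ∀ {α} → α ∈ Δ → ⟨ α , coroot α ⟩ ≡ ℕ→ℚ 2
  ⟨root,coroot⟩≡2 {α} α∈Δ = begin
    ⟨ α , coroot α ⟩                      ≡⟨ ⟨⟩-coroot α α ⟩
    (ℕ→ℚ 2 * inv ⟨ α , α ⟩) * ⟨ α , α ⟩   ≡⟨ solve 3 (λ t i a → (t :* i) :* a := t :* (a :* i)) refl (ℕ→ℚ 2) (inv ⟨ α , α ⟩) ⟨ α , α ⟩ ⟩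
    ℕ→ℚ 2 * (⟨ α , α ⟩ * inv ⟨ α , α ⟩)   ≡⟨ cong (ℕ→ℚ 2 *_) (inv-inverseʳ ⟨ α , α ⟩ (≢-sym (ℚP.<⇒≢ (⟨root,root⟩-pos α∈Δ)))) ⟩
    ℕ→ℚ 2 * 1ℚ                            ≡⟨ ℚP.*-identityʳ (ℕ→ℚ 2) ⟩
    ℕ→ℚ 2                                 ∎
    where open ≡-Reasoning

  ⟨⟩-coroot-pos : ∀ {α} x → α ∈ Δ → 0ℚ < ⟨ x , α ⟩ → 0ℚ < ⟨ x , coroot α ⟩
  ⟨⟩-coroot-pos {α} x α∈Δ 0<xα = subst (0ℚ <_) (sym (⟨⟩-coroot x α))
    (ℚP.positive⁻¹ (c * ⟨ x , α ⟩) {{ℚP.pos*pos⇒pos c {{ℚ.positive 0<c}} ⟨ x , α ⟩ {{ℚ.positive 0<xα}}}})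
    where
    c = ℕ→ℚ 2 * inv ⟨ α , α ⟩
    0<c : 0ℚ < c
    0<c = ℚP.positive⁻¹ c {{ℚP.pos*pos⇒pos (ℕ→ℚ 2) (inv ⟨ α , α ⟩) {{ℚ.positive (inv-pos ⟨ α , α ⟩ (⟨root,root⟩-pos α∈Δ))}}}}

  ⟨⟩-s : ∀ μ α x → ⟨ μ , s α x ⟩ ≡ ⟨ μ , x ⟩ - ⟨ x , coroot α ⟩ * ⟨ μ , α ⟩
  ⟨⟩-s μ α x = trans (⟨⟩--ʳ μ x (⟨ x , coroot α ⟩ ·v α)) (cong (λ t → ⟨ μ , x ⟩ - t) (⟨⟩-·ʳ μ ⟨ x , coroot α ⟩ α))

  s-self-adjoint : ∀ α x y → ⟨ s α x , y ⟩ ≡ ⟨ x , s α y ⟩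
  s-self-adjoint α x y = begin
    ⟨ s α x , y ⟩                                    ≡⟨ ⟨⟩-sym (s α x) y ⟩
    ⟨ y , s α x ⟩                                    ≡⟨ ⟨⟩-s y α x ⟩
    ⟨ y , x ⟩ - ⟨ x , coroot α ⟩ * ⟨ y , α ⟩          ≡⟨ cong₂ (λ a b → a - b * ⟨ y , α ⟩) (⟨⟩-sym y x) (⟨⟩-coroot x α) ⟩
    ⟨ x , y ⟩ - (c * ⟨ x , α ⟩) * ⟨ y , α ⟩           ≡⟨ cong (λ t → ⟨ x , y ⟩ - t)
                                                          (solve 3 (λ c a b → (c :* a) :* b := (c :* b) :* a) refl c ⟨ x , α ⟩ ⟨ y , α ⟩) ⟩
    ⟨ x , y ⟩ - (c * ⟨ y , α ⟩) * ⟨ x , α ⟩           ≡⟨ cong (λ a → ⟨ x , y ⟩ - a * ⟨ x , α ⟩) (⟨⟩-coroot y α) ⟨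
    ⟨ x , y ⟩ - ⟨ y , coroot α ⟩ * ⟨ x , α ⟩          ≡⟨ ⟨⟩-s x α y ⟨
    ⟨ x , s α y ⟩                                    ∎
    where
    open ≡-Reasoning
    c = ℕ→ℚ 2 * inv ⟨ α , α ⟩

  ⟨sx,α∨⟩≡-⟨x,α∨⟩ : ∀ {α} → α ∈ Δ → ∀ x → ⟨ s α x , coroot α ⟩ ≡ - ⟨ x , coroot α ⟩
  ⟨sx,α∨⟩≡-⟨x,α∨⟩ {α} α∈Δ x = begin
    ⟨ s α x , coroot α ⟩                                  ≡⟨ ⟨⟩-sym (s α x) (coroot α) ⟩
    ⟨ coroot α , s α x ⟩                                  ≡⟨ ⟨⟩-s (coroot α) α x ⟩
    ⟨ coroot α , x ⟩ - ⟨ x , coroot α ⟩ * ⟨ coroot α , α ⟩ ≡⟨ cong₂ (λ a b → a - ⟨ x , coroot α ⟩ * b) (⟨⟩-sym (coroot α) x)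
                                                              (trans (⟨⟩-sym (coroot α) α) (⟨root,coroot⟩≡2 α∈Δ)) ⟩
    ⟨ x , coroot α ⟩ - ⟨ x , coroot α ⟩ * ℕ→ℚ 2           ≡⟨ solve 1 (λ a → a :- a :* (con 1ℚ :+ con 1ℚ) := :- a) refl ⟨ x , coroot α ⟩ ⟩
    - ⟨ x , coroot α ⟩                                    ∎
    where open ≡-Reasoning

  s-involutive : ∀ {α} → α ∈ Δ → ∀ x → s α (s α x) ≡ x
  s-involutive {α} α∈Δ x = pairing-ext λ μ → begin
    ⟨ μ , s α (s α x) ⟩                                              ≡⟨ ⟨⟩-s μ α (s α x) ⟩
    ⟨ μ , s α x ⟩ - ⟨ s α x , coroot α ⟩ * ⟨ μ , α ⟩                  ≡⟨ cong₂ (λ a b → a - b * ⟨ μ , α ⟩) (⟨⟩-s μ α x) (⟨sx,α∨⟩≡-⟨x,α∨⟩ α∈Δ x) ⟩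
    (⟨ μ , x ⟩ - ⟨ x , coroot α ⟩ * ⟨ μ , α ⟩) - - ⟨ x , coroot α ⟩ * ⟨ μ , α ⟩
      ≡⟨ solve 3 (λ a c m → (a :- c :* m) :- (:- c) :* m := a) refl ⟨ μ , x ⟩ ⟨ x , coroot α ⟩ ⟨ μ , α ⟩ ⟩
    ⟨ μ , x ⟩                                                        ∎
    where open ≡-Reasoning

  s-injective : ∀ {α} → α ∈ Δ → ∀ {a b} → s α a ≡ s α b → a ≡ b
  s-injective {α} α∈Δ {a} {b} sa≡sb = trans (sym (s-involutive α∈Δ a)) (trans (cong (s α) sa≡sb) (s-involutive α∈Δ b))

  s-orthogonal : ∀ {α} → α ∈ Δ → ∀ x y → ⟨ s α x , s α y ⟩ ≡ ⟨ x , y ⟩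
  s-orthogonal {α} α∈Δ x y = trans (s-self-adjoint α x (s α y)) (cong ⟨ x ,_⟩ (s-involutive α∈Δ y))

  s-root : ∀ {α} → α ∈ Δ → s α α ≡ negv α
  s-root {α} α∈Δ = pairing-ext λ μ → begin
    ⟨ μ , s α α ⟩                                 ≡⟨ ⟨⟩-s μ α α ⟩
    ⟨ μ , α ⟩ - ⟨ α , coroot α ⟩ * ⟨ μ , α ⟩      ≡⟨ cong (λ c → ⟨ μ , α ⟩ - c * ⟨ μ , α ⟩) (⟨root,coroot⟩≡2 α∈Δ) ⟩
    ⟨ μ , α ⟩ - ℕ→ℚ 2 * ⟨ μ , α ⟩                 ≡⟨ solve 1 (λ a → a :- (con 1ℚ :+ con 1ℚ) :* a := :- a) refl ⟨ μ , α ⟩ ⟩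
    - ⟨ μ , α ⟩                                   ≡⟨ ⟨⟩-negʳ μ α ⟨
    ⟨ μ , negv α ⟩                                ∎
    where open ≡-Reasoning

  negv-root : ∀ {β} → β ∈ Δ → negv β ∈ Δ
  negv-root β∈Δ = subst (_∈ Δ) (s-root β∈Δ) (refl-closed β∈Δ β∈Δ)

  s-coroot-form : ∀ α x → s α x ≡ x -v ⟨ x , α ⟩ ·v coroot α
  s-coroot-form α x = pairing-ext λ μ → begin
    ⟨ μ , s α x ⟩                                  ≡⟨ ⟨⟩-s μ α x ⟩
    ⟨ μ , x ⟩ - ⟨ x , coroot α ⟩ * ⟨ μ , α ⟩       ≡⟨ cong (λ a → ⟨ μ , x ⟩ - a * ⟨ μ , α ⟩) (⟨⟩-coroot x α) ⟩
    ⟨ μ , x ⟩ - (c * ⟨ x , α ⟩) * ⟨ μ , α ⟩        ≡⟨ cong (λ t → ⟨ μ , x ⟩ - t)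
                                                       (solve 3 (λ c a m → (c :* a) :* m := a :* (c :* m)) refl c ⟨ x , α ⟩ ⟨ μ , α ⟩) ⟩
    ⟨ μ , x ⟩ - ⟨ x , α ⟩ * (c * ⟨ μ , α ⟩)        ≡⟨ cong (λ a → ⟨ μ , x ⟩ - ⟨ x , α ⟩ * a) (⟨⟩-coroot μ α) ⟨
    ⟨ μ , x ⟩ - ⟨ x , α ⟩ * ⟨ μ , coroot α ⟩       ≡⟨ cong (λ t → ⟨ μ , x ⟩ - t) (⟨⟩-·ʳ μ ⟨ x , α ⟩ (coroot α)) ⟨
    ⟨ μ , x ⟩ - ⟨ μ , ⟨ x , α ⟩ ·v coroot α ⟩      ≡⟨ ⟨⟩--ʳ μ x (⟨ x , α ⟩ ·v coroot α) ⟨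
    ⟨ μ , x -v ⟨ x , α ⟩ ·v coroot α ⟩             ∎
    where
    open ≡-Reasoning
    c = ℕ→ℚ 2 * inv ⟨ α , α ⟩

  sx+⟨x,α∨⟩α≡x : ∀ α x → s α x +v ⟨ x , coroot α ⟩ ·v α ≡ x
  sx+⟨x,α∨⟩α≡x α x = pairing-ext λ μ → begin
    ⟨ μ , s α x +v m ·v α ⟩                      ≡⟨ ⟨⟩-+ʳ μ (s α x) (m ·v α) ⟩
    ⟨ μ , s α x ⟩ + ⟨ μ , m ·v α ⟩               ≡⟨ cong₂ _+_ (⟨⟩-s μ α x) (⟨⟩-·ʳ μ m α) ⟩
    (⟨ μ , x ⟩ - m * ⟨ μ , α ⟩) + m * ⟨ μ , α ⟩  ≡⟨ solve 2 (λ a b → (a :- b) :+ b := a) refl ⟨ μ , x ⟩ (m * ⟨ μ , α ⟩) ⟩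
    ⟨ μ , x ⟩                                    ∎
    where
    open ≡-Reasoning
    m = ⟨ x , coroot α ⟩

  x-sx≡⟨x,α∨⟩α : ∀ α x → x +v negv (s α x) ≡ ⟨ x , coroot α ⟩ ·v α
  x-sx≡⟨x,α∨⟩α α x = pairing-ext λ μ → begin
    ⟨ μ , x +v negv (s α x) ⟩                    ≡⟨ ⟨⟩-+ʳ μ x (negv (s α x)) ⟩
    ⟨ μ , x ⟩ + ⟨ μ , negv (s α x) ⟩             ≡⟨ cong (⟨ μ , x ⟩ +_) (trans (⟨⟩-negʳ μ (s α x)) (cong -_ (⟨⟩-s μ α x))) ⟩
    ⟨ μ , x ⟩ + - (⟨ μ , x ⟩ - m * ⟨ μ , α ⟩)    ≡⟨ solve 2 (λ a b → a :+ :- (a :- b) := b) refl ⟨ μ , x ⟩ (m * ⟨ μ , α ⟩) ⟩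
    m * ⟨ μ , α ⟩                                ≡⟨ ⟨⟩-·ʳ μ m α ⟨
    ⟨ μ , m ·v α ⟩                               ∎
    where
    open ≡-Reasoning
    m = ⟨ x , coroot α ⟩

  -- Surjective isometries are linear; this is how linearity of Weyl group elements is obtained.
  module Isometry (f g : V n → V n) (f-orth : ∀ x y → ⟨ f x , f y ⟩ ≡ ⟨ x , y ⟩)
                  (f∘g≗id : ∀ x → f (g x) ≡ x) where

    adjoint : ∀ μ x → ⟨ μ , f x ⟩ ≡ ⟨ g μ , x ⟩
    adjoint μ x = trans (cong (λ ν → ⟨ ν , f x ⟩) (sym (f∘g≗id μ))) (f-orth (g μ) x)

    f-negv : ∀ x → f (negv x) ≡ negv (f x)
    f-negv x = pairing-ext λ μ → begin
      ⟨ μ , f (negv x) ⟩  ≡⟨ adjoint μ (negv x) ⟩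
      ⟨ g μ , negv x ⟩    ≡⟨ ⟨⟩-negʳ (g μ) x ⟩
      - ⟨ g μ , x ⟩       ≡⟨ cong -_ (adjoint μ x) ⟨
      - ⟨ μ , f x ⟩       ≡⟨ ⟨⟩-negʳ μ (f x) ⟨
      ⟨ μ , negv (f x) ⟩  ∎
      where open ≡-Reasoning

    f-lincomb : ∀ {k} (c : Fin k → ℚ) (v : Fin k → V n) → f (lincomb c v) ≡ lincomb c (f ∘ v)
    f-lincomb c v = pairing-ext λ μ → begin
      ⟨ μ , f (lincomb c v) ⟩                ≡⟨ adjoint μ (lincomb c v) ⟩
      ⟨ g μ , lincomb c v ⟩                  ≡⟨ ⟨⟩-lincomb (g μ) c v ⟩
      sumFin (λ i → c i * ⟨ g μ , v i ⟩)     ≡⟨ sumFin-cong (λ i → cong (c i *_) (adjoint μ (v i))) ⟨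
      sumFin (λ i → c i * ⟨ μ , f (v i) ⟩)   ≡⟨ ⟨⟩-lincomb μ c (f ∘ v) ⟨
      ⟨ μ , lincomb c (f ∘ v) ⟩              ∎
      where open ≡-Reasoning

    ⟨f,coroot-f⟩ : ∀ x γ → ⟨ f x , coroot (f γ) ⟩ ≡ ⟨ x , coroot γ ⟩
    ⟨f,coroot-f⟩ x γ = begin
      ⟨ f x , coroot (f γ) ⟩                          ≡⟨ ⟨⟩-coroot (f x) (f γ) ⟩
      (ℕ→ℚ 2 * inv ⟨ f γ , f γ ⟩) * ⟨ f x , f γ ⟩     ≡⟨ cong₂ (λ a b → (ℕ→ℚ 2 * inv a) * b) (f-orth γ γ) (f-orth x γ) ⟩
      (ℕ→ℚ 2 * inv ⟨ γ , γ ⟩) * ⟨ x , γ ⟩             ≡⟨ ⟨⟩-coroot x γ ⟨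
      ⟨ x , coroot γ ⟩                                ∎
      where open ≡-Reasoning

    s-conjugate : ∀ γ x → s (f γ) (f x) ≡ f (s γ x)
    s-conjugate γ x = pairing-ext λ μ → begin
      ⟨ μ , s (f γ) (f x) ⟩                                         ≡⟨ ⟨⟩-s μ (f γ) (f x) ⟩
      ⟨ μ , f x ⟩ - ⟨ f x , coroot (f γ) ⟩ * ⟨ μ , f γ ⟩            ≡⟨ cong₂ (λ a b → a - b) (adjoint μ x)
                                                                         (cong₂ _*_ (⟨f,coroot-f⟩ x γ) (adjoint μ γ)) ⟩
      ⟨ g μ , x ⟩ - ⟨ x , coroot γ ⟩ * ⟨ g μ , γ ⟩                  ≡⟨ ⟨⟩-s (g μ) γ x ⟨
      ⟨ g μ , s γ x ⟩                                               ≡⟨ adjoint μ (s γ x) ⟨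
      ⟨ μ , f (s γ x) ⟩                                             ∎
      where open ≡-Reasoning

  actW-++ : ∀ (v v′ : WordW R) x → actW R (v ++ v′) x ≡ actW R v (actW R v′ x)
  actW-++ []            v′ x = refl
  actW-++ ((α , _) ∷ v) v′ x = cong (s α) (actW-++ v v′ x)

  actW-orthogonal : ∀ (v : WordW R) x y → ⟨ actW R v x , actW R v y ⟩ ≡ ⟨ x , y ⟩
  actW-orthogonal []              x y = refl
  actW-orthogonal ((α , α∈Δ) ∷ v) x y = trans (s-orthogonal α∈Δ (actW R v x) (actW R v y)) (actW-orthogonal v x y)

  actW-root : ∀ (v : WordW R) {β} → β ∈ Δ → actW R v β ∈ Δ
  actW-root []                β∈Δ = β∈Δ
  actW-root ((α , α∈Δ) ∷ v) β∈Δ = refl-closed α∈Δ (actW-root v β∈Δ)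

  actW-reverse-inverseˡ : ∀ (v : WordW R) x → actW R (reverse v) (actW R v x) ≡ x
  actW-reverse-inverseˡ []                    x = refl
  actW-reverse-inverseˡ ((α , α∈Δ) ∷ v) x = begin
    actW R (reverse ((α , α∈Δ) ∷ v)) (s α (actW R v x))     ≡⟨ cong (λ u → actW R u (s α (actW R v x))) (LP.unfold-reverse (α , α∈Δ) v) ⟩
    actW R (reverse v ++ [ α , α∈Δ ]) (s α (actW R v x))    ≡⟨ actW-++ (reverse v) [ α , α∈Δ ] (s α (actW R v x)) ⟩
    actW R (reverse v) (s α (s α (actW R v x)))             ≡⟨ cong (actW R (reverse v)) (s-involutive α∈Δ (actW R v x)) ⟩
    actW R (reverse v) (actW R v x)                         ≡⟨ actW-reverse-inverseˡ v x ⟩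
    x                                                       ∎
    where open ≡-Reasoning

  actW-reverse-inverseʳ : ∀ (v : WordW R) x → actW R v (actW R (reverse v) x) ≡ x
  actW-reverse-inverseʳ v x =
    trans (cong (λ u → actW R u (actW R (reverse v) x)) (sym (LP.reverse-involutive v)))
          (actW-reverse-inverseˡ (reverse v) x)

  module actW-isometry (v : WordW R) =
    Isometry (actW R v) (actW R (reverse v)) (actW-orthogonal v) (actW-reverse-inverseʳ v)

  SimpleWord : Set
  SimpleWord = List (Fin p)

  word : SimpleWord → WordW R
  word = List.map (λ i → simple i , simple-in i)

  actS : SimpleWord → V n → V n
  actS K = actW R (word K)

  actS-++ : ∀ K L x → actS (K ++ L) x ≡ actS K (actS L x)
  actS-++ K L x = trans (cong (λ u → actW R u x) (LP.map-++ _ K L)) (actW-++ (word K) (word L) x)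

  actS-root : ∀ K {β} → β ∈ Δ → actS K β ∈ Δ
  actS-root K = actW-root (word K)

  actS-reverse-inverseʳ : ∀ K x → actS K (actS (reverse K) x) ≡ x
  actS-reverse-inverseʳ K x =
    trans (cong (λ u → actS K (actW R u x)) (LP.reverse-map _ K)) (actW-reverse-inverseʳ (word K) x)

  module actS-isometry (K : SimpleWord) = actW-isometry (word K)

  -- Positive roots

  lincomb-simple-injective : ∀ (a b : Fin p → ℚ) → lincomb a simple ≡ lincomb b simple → ∀ i → a i ≡ b i
  lincomb-simple-injective a b a≡b i = x-y≡0⇒x≡y (a i) (b i) (simple-indep (λ l → a l - b l) a-b≡0 i)
    where
    a-b≡0 : lincomb (λ l → a l - b l) simple ≡ 0v
    a-b≡0 = pairing-ext λ μ → begin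
      ⟨ μ , lincomb (λ l → a l - b l) simple ⟩                     ≡⟨ ⟨⟩-lincomb μ (λ l → a l - b l) simple ⟩
      sumFin (λ l → (a l - b l) * M μ l)                           ≡⟨ sumFin-cong (λ l → solve 3 (λ a b m → (a :- b) :* m := con 1ℚ :* (a :* m) :+ con (- 1ℚ) :* (b :* m))
                                                                         refl (a l) (b l) (M μ l)) ⟩
      sumFin (λ l → 1ℚ * (a l * M μ l) + - 1ℚ * (b l * M μ l))     ≡⟨ sumFin-linear 1ℚ (- 1ℚ) (λ l → a l * M μ l) (λ l → b l * M μ l) ⟩
      1ℚ * sumFin (λ l → a l * M μ l) + - 1ℚ * sumFin (λ l → b l * M μ l)
        ≡⟨ sym (cong₂ (λ x y → 1ℚ * x + - 1ℚ * y) (⟨⟩-lincomb μ a simple) (⟨⟩-lincomb μ b simple)) ⟩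
      1ℚ * ⟨ μ , lincomb a simple ⟩ + - 1ℚ * ⟨ μ , lincomb b simple ⟩
        ≡⟨ cong (λ x → 1ℚ * ⟨ μ , x ⟩ + - 1ℚ * ⟨ μ , lincomb b simple ⟩) a≡b ⟩
      1ℚ * ⟨ μ , lincomb b simple ⟩ + - 1ℚ * ⟨ μ , lincomb b simple ⟩
        ≡⟨ solve 1 (λ x → con 1ℚ :* x :+ con (- 1ℚ) :* x := con 0ℚ) refl ⟨ μ , lincomb b simple ⟩ ⟩
      0ℚ                                                           ≡⟨ ⟨⟩-0ʳ μ ⟨
      ⟨ μ , 0v ⟩                                                   ∎
      where
      open ≡-Reasoning
      M : V n → Fin p → ℚ
      M μ l = ⟨ μ , simple l ⟩

  ℕ-comb : (Fin p → ℕ) → V n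
  ℕ-comb c = lincomb (λ i → ℕ→ℚ (c i)) simple

  InQ⁺ : V n → Set
  InQ⁺ x = ∃ λ c → x ≡ ℕ-comb c

  InQ⁺-0v : InQ⁺ 0v
  InQ⁺-0v = (λ _ → 0) , sym (lincomb-zero simple)

  ℕ-comb-+ : ∀ c d → ℕ-comb c +v ℕ-comb d ≡ lincomb (λ i → ℕ→ℚ (c i) + ℕ→ℚ (d i)) simple
  ℕ-comb-+ c d = lincomb-+ (λ i → ℕ→ℚ (c i)) (λ i → ℕ→ℚ (d i)) simple

  InQ⁺-+ : ∀ {x y} → InQ⁺ x → InQ⁺ y → InQ⁺ (x +v y)
  InQ⁺-+ (c , refl) (d , refl) = (λ i → c i ℕ.+ d i) ,
    trans (ℕ-comb-+ c d) (lincomb-cong simple λ i → sym (ℤ→ℚ-homo-+ (ℤ.+ c i) (ℤ.+ d i)))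

  InQ⁺-ℕ· : ∀ a {x} → InQ⁺ x → InQ⁺ (ℕ→ℚ a ·v x)
  InQ⁺-ℕ· a (c , refl) = (λ i → a ℕ.* c i) ,
    trans (lincomb-· (ℕ→ℚ a) (λ i → ℕ→ℚ (c i)) simple)
          (lincomb-cong simple λ i → sym (trans (cong ℤ→ℚ (ℤP.pos-* a (c i))) (ℤ→ℚ-homo-* (ℤ.+ a) (ℤ.+ c i))))

  simple-InQ⁺ : ∀ i → InQ⁺ (simple i)
  simple-InQ⁺ i = δ i , sym (lincomb-δ i simple)

  InQ⁺-pointed : ∀ {x} → InQ⁺ x → InQ⁺ (negv x) → x ≡ 0v
  InQ⁺-pointed {x} (c , x≡c) (d , -x≡d) = begin
    x                               ≡⟨ x≡c ⟩
    ℕ-comb c                        ≡⟨ lincomb-cong simple c≡0 ⟩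
    lincomb (λ _ → 0ℚ) simple       ≡⟨ lincomb-zero simple ⟩
    0v                              ∎
    where
    open ≡-Reasoning
    c+d≡0 : ∀ i → ℕ→ℚ (c i) + ℕ→ℚ (d i) ≡ 0ℚ
    c+d≡0 = lincomb-simple-injective _ (λ _ → 0ℚ) (begin
      lincomb (λ i → ℕ→ℚ (c i) + ℕ→ℚ (d i)) simple   ≡⟨ ℕ-comb-+ c d ⟨
      ℕ-comb c +v ℕ-comb d                           ≡⟨ cong₂ _+v_ x≡c -x≡d ⟨
      x +v negv x                                    ≡⟨ +v-inverseʳ x ⟩
      0v                                             ≡⟨ lincomb-zero simple ⟨
      lincomb (λ _ → 0ℚ) simple                      ∎)
    c≡0 : ∀ i → ℕ→ℚ (c i) ≡ 0ℚ
    c≡0 i = nonNeg+nonNeg≡0⇒≡0 (ℕ→ℚ-nonNeg (c i)) (ℕ→ℚ-nonNeg (d i)) (c+d≡0 i)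

  root-sign : ∀ {β} → β ∈ Δ → InQ⁺ β ⊎ InQ⁺ (negv β)
  root-sign β∈Δ with base β∈Δ
  ... | c , inj₁ β≡c  = inj₁ (c , β≡c)
  ... | c , inj₂ -β≡c = inj₂ (c , -β≡c)

  negative-sᵢβ⇒β≡αᵢ : ∀ {β} i → β ∈ Δ → InQ⁺ β → InQ⁺ (negv (s (simple i) β)) → β ≡ simple i
  negative-sᵢβ⇒β≡αᵢ {β} i β∈Δ (c , β≡c) (d , -sβ≡d) =
    Cᵢ≡±1⇒β≡αᵢ (reduced (C i) (simple-in i) (subst (_∈ Δ) β≡Cᵢαᵢ β∈Δ))
    where
    open ≡-Reasoning
    α = simple i
    m = ⟨ β , coroot α ⟩
    C D : Fin p → ℚ
    C l = ℕ→ℚ (c l)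
    D l = ℕ→ℚ (d l)
    C+D≡mδ : ∀ l → C l + D l ≡ m * ℕ→ℚ (δ i l)
    C+D≡mδ = lincomb-simple-injective _ _ (begin
      lincomb (λ l → C l + D l) simple              ≡⟨ ℕ-comb-+ c d ⟨
      ℕ-comb c +v ℕ-comb d                          ≡⟨ cong₂ _+v_ β≡c -sβ≡d ⟨
      β +v negv (s α β)                             ≡⟨ x-sx≡⟨x,α∨⟩α α β ⟩
      m ·v α                                        ≡⟨ ·v-as-lincomb m i simple ⟩
      lincomb (λ l → m * ℕ→ℚ (δ i l)) simple        ∎)
    Cₗ≡0 : ∀ l → i ≢ l → C l ≡ 0ℚ
    Cₗ≡0 l i≢l = nonNeg+nonNeg≡0⇒≡0 (ℕ→ℚ-nonNeg (c l)) (ℕ→ℚ-nonNeg (d l))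
      (trans (C+D≡mδ l) (trans (cong (λ t → m * ℕ→ℚ t) (δ-≢ i≢l)) (ℚP.*-zeroʳ m)))
    β≡Cᵢαᵢ : β ≡ C i ·v α
    β≡Cᵢαᵢ = trans β≡c (lincomb-single C simple i Cₗ≡0)
    Cᵢ≡±1⇒β≡αᵢ : (C i ≡ 1ℚ) ⊎ (C i ≡ - 1ℚ) → β ≡ α
    Cᵢ≡±1⇒β≡αᵢ (inj₁ Cᵢ≡1)  = trans β≡Cᵢαᵢ (trans (cong (_·v α) Cᵢ≡1) (·v-identityˡ α))
    Cᵢ≡±1⇒β≡αᵢ (inj₂ Cᵢ≡-1) =
      ⊥-elim (ℚP.<-irrefl refl (ℚP.<-≤-trans (ℚP.negative⁻¹ (- 1ℚ)) (subst (0ℚ ≤_) Cᵢ≡-1 (ℕ→ℚ-nonNeg (c i)))))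

  β≡αᵢ⊎sᵢβ>0 : ∀ i {β} → β ∈ Δ → InQ⁺ β → β ≡ simple i ⊎ InQ⁺ (s (simple i) β)
  β≡αᵢ⊎sᵢβ>0 i β∈Δ β>0 with root-sign (refl-closed (simple-in i) β∈Δ)
  ... | inj₁ sβ>0  = inj₂ sβ>0
  ... | inj₂ -sβ>0 = inj₁ (negative-sᵢβ⇒β≡αᵢ i β∈Δ β>0 -sβ>0)

  InQ⁺-pairs-positively-with-simple : ∀ {x} → InQ⁺ x → 0ℚ < ⟨ x , x ⟩ → ∃ λ k → 0ℚ < ⟨ x , simple k ⟩
  InQ⁺-pairs-positively-with-simple {x} (c , x≡c) 0<xx
    with positive-sumFin⇒positive-term (λ k → ℕ→ℚ (c k) * ⟨ x , simple k ⟩)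
           (subst (0ℚ <_) (trans (cong ⟨ x ,_⟩ x≡c) (⟨⟩-lincomb x (λ i → ℕ→ℚ (c i)) simple)) 0<xx)
  ... | k , 0<cₖxₖ = k , 0<c*t⇒0<t (ℕ→ℚ-nonNeg (c k)) 0<cₖxₖ

  height-s-decreasing : ∀ {β} k c d → β ≡ ℕ-comb c → s (simple k) β ≡ ℕ-comb d →
                        0ℚ < ⟨ β , coroot (simple k) ⟩ → ∑ℕ d ℕ.< ∑ℕ c
  height-s-decreasing {β} k c d β≡c sβ≡d 0<m = ℕ→ℚ-cancel-< (subst (ℕ→ℚ (∑ℕ d) <_) Σd+m≡Σc
    (subst (_< ℕ→ℚ (∑ℕ d) + m) (ℚP.+-identityʳ (ℕ→ℚ (∑ℕ d))) (ℚP.+-monoʳ-< (ℕ→ℚ (∑ℕ d)) 0<m)))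
    where
    open ≡-Reasoning
    α = simple k
    m = ⟨ β , coroot α ⟩
    C D : Fin p → ℚ
    C l = ℕ→ℚ (c l)
    D l = ℕ→ℚ (d l)
    d+mδ≡c : ∀ l → D l + ℕ→ℚ (δ k l) * m ≡ C l
    d+mδ≡c = lincomb-simple-injective _ _ (begin
      lincomb (λ l → D l + ℕ→ℚ (δ k l) * m) simple                       ≡⟨ lincomb-cong simple (λ l → cong (D l +_) (ℚP.*-comm m (ℕ→ℚ (δ k l)))) ⟨
      lincomb (λ l → D l + m * ℕ→ℚ (δ k l)) simple                       ≡⟨ lincomb-+ D (λ l → m * ℕ→ℚ (δ k l)) simple ⟨
      ℕ-comb d +v lincomb (λ l → m * ℕ→ℚ (δ k l)) simple                 ≡⟨ cong₂ _+v_ sβ≡d (·v-as-lincomb m k simple) ⟨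
      s α β +v m ·v α                                                    ≡⟨ sx+⟨x,α∨⟩α≡x α β ⟩
      β                                                                  ≡⟨ β≡c ⟩
      lincomb C simple                                                   ∎)
    Σd+m≡Σc : ℕ→ℚ (∑ℕ d) + m ≡ ℕ→ℚ (∑ℕ c)
    Σd+m≡Σc = begin
      ℕ→ℚ (∑ℕ d) + m                                     ≡⟨ cong₂ _+_ (ℕ→ℚ-homo-∑ d) (sym (sumFin-δ k (λ _ → m))) ⟩
      sumFin D + sumFin (λ l → ℕ→ℚ (δ k l) * m)          ≡⟨ sumFin-distrib-+ D (λ l → ℕ→ℚ (δ k l) * m) ⟨
      sumFin (λ l → D l + ℕ→ℚ (δ k l) * m)               ≡⟨ sumFin-cong d+mδ≡c ⟩
      sumFin C                                           ≡⟨ ℕ→ℚ-homo-∑ c ⟨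
      ℕ→ℚ (∑ℕ c)                                         ∎

  positive-root-conjugate-to-simple : ∀ {β} c → β ∈ Δ → β ≡ ℕ-comb c → Acc ℕ._<_ (∑ℕ c) →
                                      ∃₂ λ K i → β ≡ actS K (simple i)
  positive-root-conjugate-to-simple {β} c β∈Δ β≡c (acc smaller) =
    descend (InQ⁺-pairs-positively-with-simple (c , β≡c) (⟨root,root⟩-pos β∈Δ))
    where
    descend : (∃ λ k → 0ℚ < ⟨ β , simple k ⟩) → ∃₂ λ K i → β ≡ actS K (simple i)
    descend (k , 0<βₖ) = reflect (β≡αᵢ⊎sᵢβ>0 k β∈Δ (c , β≡c))
      where
      αₖ = simple k
      reflect : β ≡ αₖ ⊎ InQ⁺ (s αₖ β) → ∃₂ λ K i → β ≡ actS K (simple i)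
      reflect (inj₁ β≡αₖ)       = [] , k , β≡αₖ
      reflect (inj₂ (d , sβ≡d)) = prepend (positive-root-conjugate-to-simple d (refl-closed (simple-in k) β∈Δ) sβ≡d
                                    (smaller (height-s-decreasing k c d β≡c sβ≡d (⟨⟩-coroot-pos β (simple-in k) 0<βₖ))))
        where
        prepend : (∃₂ λ K i → s αₖ β ≡ actS K (simple i)) → ∃₂ λ K i → β ≡ actS K (simple i)
        prepend (K , i , sβ≡Kαᵢ) = k ∷ K , i , trans (sym (s-involutive (simple-in k) β)) (cong (s αₖ) sβ≡Kαᵢ)

  root-conjugate-to-simple : ∀ {β} → β ∈ Δ → ∃₂ λ K i → β ≡ actS K (simple i)
  root-conjugate-to-simple {β} β∈Δ = by-sign (root-sign β∈Δ)
    where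
    negate : (∃₂ λ K i → negv β ≡ actS K (simple i)) → ∃₂ λ K i → β ≡ actS K (simple i)
    negate (K , i , -β≡Kαᵢ) = K ++ [ i ] , i , (begin
      β                            ≡⟨ negv-involutive β ⟨
      negv (negv β)                ≡⟨ cong negv -β≡Kαᵢ ⟩
      negv (actS K αᵢ)             ≡⟨ actS-isometry.f-negv K αᵢ ⟨
      actS K (negv αᵢ)             ≡⟨ cong (actS K) (s-root (simple-in i)) ⟨
      actS K (s αᵢ αᵢ)             ≡⟨ actS-++ K [ i ] αᵢ ⟨
      actS (K ++ [ i ]) αᵢ         ∎)
      where
      open ≡-Reasoning
      αᵢ = simple i
    by-sign : InQ⁺ β ⊎ InQ⁺ (negv β) → ∃₂ λ K i → β ≡ actS K (simple i)
    by-sign (inj₁ (c , β≡c))  = positive-root-conjugate-to-simple c β∈Δ β≡c (<-wellFounded _)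
    by-sign (inj₂ (c , -β≡c)) = negate (positive-root-conjugate-to-simple c (negv-root β∈Δ) -β≡c (<-wellFounded _))

  s-as-simple-word : ∀ {β} → β ∈ Δ → ∃ λ K → ∀ x → s β x ≡ actS K x
  s-as-simple-word {β} β∈Δ = conjugate (root-conjugate-to-simple β∈Δ)
    where
    conjugate : (∃₂ λ M i → β ≡ actS M (simple i)) → ∃ λ K → ∀ x → s β x ≡ actS K x
    conjugate (M , i , refl) = M ++ i ∷ reverse M , λ x → begin
      s (actS M αᵢ) x                              ≡⟨ cong (s (actS M αᵢ)) (actS-reverse-inverseʳ M x) ⟨
      s (actS M αᵢ) (actS M (actS (reverse M) x))  ≡⟨ actS-isometry.s-conjugate M αᵢ (actS (reverse M) x) ⟩
      actS M (s αᵢ (actS (reverse M) x))           ≡⟨ actS-++ M (i ∷ reverse M) x ⟨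
      actS (M ++ i ∷ reverse M) x                  ∎
      where
      open ≡-Reasoning
      αᵢ = simple i

  word-as-simple-word : ∀ (v : WordW R) → ∃ λ K → ∀ x → actW R v x ≡ actS K x
  word-as-simple-word [] = [] , λ x → refl
  word-as-simple-word ((β , β∈Δ) ∷ v) = compose (s-as-simple-word β∈Δ) (word-as-simple-word v)
    where
    compose : (∃ λ K → ∀ x → s β x ≡ actS K x) → (∃ λ L → ∀ x → actW R v x ≡ actS L x) →
              ∃ λ K → ∀ x → s β (actW R v x) ≡ actS K x
    compose (K , sβ≗K) (L , v≗L) = K ++ L , λ x → begin
      s β (actW R v x)     ≡⟨ sβ≗K (actW R v x) ⟩
      actS K (actW R v x)  ≡⟨ cong (actS K) (v≗L x) ⟩
      actS K (actS L x)    ≡⟨ actS-++ K L x ⟨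
      actS (K ++ L) x      ∎
      where open ≡-Reasoning

  deletion : ∀ K {γ} → γ ∈ Δ → InQ⁺ γ → InQ⁺ (negv (actS K γ)) →
             ∃ λ K′ → length K′ ℕ.< length K × (∀ y → actS K′ y ≡ actS K (s γ y))
  deletion []      γ∈Δ γ>0 -γ>0 = ⊥-elim (nonzero γ∈Δ (InQ⁺-pointed γ>0 -γ>0))
  deletion (i ∷ K) {γ} γ∈Δ γ>0 -iKγ>0 = by-sign (root-sign (actS-root K γ∈Δ))
    where
    αᵢ = simple i
    by-sign : InQ⁺ (actS K γ) ⊎ InQ⁺ (negv (actS K γ)) →
              ∃ λ K′ → length K′ ℕ.< suc (length K) × (∀ y → actS K′ y ≡ s αᵢ (actS K (s γ y)))
    by-sign (inj₁ Kγ>0) = K , ℕP.n<1+n (length K) , λ y → begin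
      actS K y                                  ≡⟨ s-involutive (simple-in i) (actS K y) ⟨
      s αᵢ (s αᵢ (actS K y))                    ≡⟨ cong (λ α → s αᵢ (s α (actS K y))) Kγ≡αᵢ ⟨
      s αᵢ (s (actS K γ) (actS K y))            ≡⟨ cong (s αᵢ) (actS-isometry.s-conjugate K γ y) ⟩
      s αᵢ (actS K (s γ y))                     ∎
      where
      open ≡-Reasoning
      Kγ≡αᵢ : actS K γ ≡ αᵢ
      Kγ≡αᵢ = negative-sᵢβ⇒β≡αᵢ i (actS-root K γ∈Δ) Kγ>0 -iKγ>0
    by-sign (inj₂ -Kγ>0) with deletion K γ∈Δ γ>0 -Kγ>0
    ... | K′ , K′<K , K′≗Ksγ = i ∷ K′ , ℕ.s≤s K′<K , λ y → cong (s αᵢ) (K′≗Ksγ y)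

  -- Writing K = L sᵢ, L(αᵢ) = -K(αᵢ) is negative, so the deletion condition shortens K.
  positive-on-simple⇒identity : ∀ K → Acc ℕ._<_ (length K) →
                                (∀ j → InQ⁺ (actS K (simple j))) → ∀ y → actS K y ≡ y
  positive-on-simple⇒identity K rec K>0 = by-last (initLast K) rec K>0
    where
    by-last : ∀ {K} → InitLast K → Acc ℕ._<_ (length K) → (∀ j → InQ⁺ (actS K (simple j))) → ∀ y → actS K y ≡ y
    by-last []          _             _   y = refl
    by-last (L ∷ʳ′ i) (acc smaller) K>0 = shorten (deletion L (simple-in i) (simple-InQ⁺ i) -Lαᵢ>0)
      where
      αᵢ = simple i
      -Lαᵢ>0 : InQ⁺ (negv (actS L αᵢ))
      -Lαᵢ>0 = subst InQ⁺ (begin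
        actS (L ∷ʳ i) αᵢ         ≡⟨ actS-++ L [ i ] αᵢ ⟩
        actS L (s αᵢ αᵢ)         ≡⟨ cong (actS L) (s-root (simple-in i)) ⟩
        actS L (negv αᵢ)         ≡⟨ actS-isometry.f-negv L αᵢ ⟩
        negv (actS L αᵢ)         ∎) (K>0 i)
        where open ≡-Reasoning
      shorten : (∃ λ L′ → length L′ ℕ.< length L × (∀ y → actS L′ y ≡ actS L (s αᵢ y))) →
                ∀ y → actS (L ∷ʳ i) y ≡ y
      shorten (L′ , L′<L , L′≗Lsᵢ) y = begin
        actS (L ∷ʳ i) y         ≡⟨ L′≗K y ⟨
        actS L′ y               ≡⟨ positive-on-simple⇒identity L′ (smaller L′<K) L′>0 y ⟩
        y                       ∎
        where
        open ≡-Reasoning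
        L′≗K : ∀ x → actS L′ x ≡ actS (L ∷ʳ i) x
        L′≗K x = trans (L′≗Lsᵢ x) (sym (actS-++ L [ i ] x))
        L′>0 : ∀ j → InQ⁺ (actS L′ (simple j))
        L′>0 j = subst InQ⁺ (sym (L′≗K (simple j))) (K>0 j)
        L′<K : length L′ ℕ.< length (L ∷ʳ i)
        L′<K = ℕP.<-trans L′<L (subst (length L ℕ.<_) (sym (LP.length-++ L)) (ℕP.m<m+n (length L) (ℕ.s≤s ℕ.z≤n)))

  -- The coroot lattice

  InQ∨-integral : ∀ {x} → InQ∨ R x → ∀ i → ∃ λ z → ⟨ x , simple i ⟩ ≡ ℤ→ℚ z
  InQ∨-integral (k , refl) i = ∑ℤ (λ j → k j ℤ.* a j) , (begin
    ⟨ corootLattice R k , αᵢ ⟩                           ≡⟨ ⟨⟩-sym (corootLattice R k) αᵢ ⟩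
    ⟨ αᵢ , corootLattice R k ⟩                           ≡⟨ ⟨⟩-lincomb αᵢ (λ j → ℤ→ℚ (k j)) (λ j → coroot (simple j)) ⟩
    sumFin (λ j → ℤ→ℚ (k j) * ⟨ αᵢ , coroot (simple j) ⟩) ≡⟨ sumFin-cong (λ j → cong (ℤ→ℚ (k j) *_) (a-spec j)) ⟩
    sumFin (λ j → ℤ→ℚ (k j) * ℤ→ℚ (a j))                 ≡⟨ sumFin-cong (λ j → ℤ→ℚ-homo-* (k j) (a j)) ⟨
    sumFin (λ j → ℤ→ℚ (k j ℤ.* a j))                     ≡⟨ ℤ→ℚ-homo-∑ (λ j → k j ℤ.* a j) ⟨
    ℤ→ℚ (∑ℤ (λ j → k j ℤ.* a j))                         ∎)
    where
    open ≡-Reasoning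
    αᵢ = simple i
    a : Fin p → ℤ
    a j = proj₁ (crystallographic (simple-in j) (simple-in i))
    a-spec : ∀ j → ⟨ αᵢ , coroot (simple j) ⟩ ≡ ℤ→ℚ (a j)
    a-spec j = proj₂ (crystallographic (simple-in j) (simple-in i))

  s-simple-corootLattice : ∀ i k z → ⟨ corootLattice R k , simple i ⟩ ≡ ℤ→ℚ z →
                           s (simple i) (corootLattice R k) ≡ corootLattice R (λ j → k j ℤ.- z ℤ.* ℤ.+ δ i j)
  s-simple-corootLattice i k z ⟨x,αᵢ⟩≡z = begin
    s αᵢ x                                                     ≡⟨ s-coroot-form αᵢ x ⟩
    x -v ⟨ x , αᵢ ⟩ ·v coroot αᵢ                               ≡⟨ cong (λ t → x +v negv (t ·v coroot αᵢ)) ⟨x,αᵢ⟩≡z ⟩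
    x +v negv (Z ·v coroot αᵢ)                                 ≡⟨ cong (x +v_) (negv-·v Z (coroot αᵢ)) ⟩
    x +v (- Z) ·v coroot αᵢ                                    ≡⟨ cong (x +v_) (·v-as-lincomb (- Z) i coroots) ⟩
    x +v lincomb (λ j → - Z * ℕ→ℚ (δ i j)) coroots             ≡⟨ lincomb-+ (λ j → ℤ→ℚ (k j)) (λ j → - Z * ℕ→ℚ (δ i j)) coroots ⟩
    lincomb (λ j → ℤ→ℚ (k j) + - Z * ℕ→ℚ (δ i j)) coroots      ≡⟨ lincomb-cong coroots (λ j → sym (coefficient j)) ⟩
    corootLattice R (λ j → k j ℤ.- z ℤ.* ℤ.+ δ i j)            ∎
    where
    open ≡-Reasoning
    x = corootLattice R k
    αᵢ = simple i
    Z = ℤ→ℚ z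
    coroots : Fin p → V n
    coroots j = coroot (simple j)
    coefficient : ∀ j → ℤ→ℚ (k j ℤ.- z ℤ.* ℤ.+ δ i j) ≡ ℤ→ℚ (k j) + - Z * ℕ→ℚ (δ i j)
    coefficient j = begin
      ℤ→ℚ (k j ℤ.- z ℤ.* ℤ.+ δ i j)                 ≡⟨ ℤ→ℚ-homo-+ (k j) (ℤ.- (z ℤ.* ℤ.+ δ i j)) ⟩
      ℤ→ℚ (k j) + ℤ→ℚ (ℤ.- (z ℤ.* ℤ.+ δ i j))       ≡⟨ cong (ℤ→ℚ (k j) +_) (ℤ→ℚ-homo‿- (z ℤ.* ℤ.+ δ i j)) ⟩
      ℤ→ℚ (k j) + - ℤ→ℚ (z ℤ.* ℤ.+ δ i j)           ≡⟨ cong (λ t → ℤ→ℚ (k j) + - t) (ℤ→ℚ-homo-* z (ℤ.+ δ i j)) ⟩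
      ℤ→ℚ (k j) + - (Z * ℕ→ℚ (δ i j))               ≡⟨ cong (ℤ→ℚ (k j) +_) (ℚP.neg-distribˡ-* Z (ℕ→ℚ (δ i j))) ⟩
      ℤ→ℚ (k j) + - Z * ℕ→ℚ (δ i j)                 ∎

  s-simple-InQ∨ : ∀ i {x} → InQ∨ R x → InQ∨ R (s (simple i) x)
  s-simple-InQ∨ i x∈Q∨@(k , refl) =
    let z , ⟨x,αᵢ⟩≡z = InQ∨-integral x∈Q∨ i in (λ j → k j ℤ.- z ℤ.* ℤ.+ δ i j) , s-simple-corootLattice i k z ⟨x,αᵢ⟩≡z

  actS-InQ∨ : ∀ K {x} → InQ∨ R x → InQ∨ R (actS K x)
  actS-InQ∨ []      x∈Q∨ = x∈Q∨
  actS-InQ∨ (i ∷ K) x∈Q∨ = s-simple-InQ∨ i (actS-InQ∨ K x∈Q∨)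

  actW-InQ∨ : ∀ v {x} → InQ∨ R x → InQ∨ R (actW R v x)
  actW-InQ∨ v {x} x∈Q∨ = let K , v≗K = word-as-simple-word v in
    subst (InQ∨ R) (sym (v≗K x)) (actS-InQ∨ K x∈Q∨)

  -- s-maximality in terms of v(r)

  actŴ-level : ∀ v r {μ k τ c} → actŴ R (v ·t r) (μ , k) ≡ (τ , c) → k ≡ c + ⟨ τ , vr R (v ·t r) ⟩
  actŴ-level v r {μ} {k} refl = begin
    k                                                       ≡⟨ solve 2 (λ k a → k := (k :- a) :+ a) refl k ⟨ μ , x ⟩ ⟩
    (k - ⟨ μ , x ⟩) + ⟨ μ , x ⟩                             ≡⟨ cong ((k - ⟨ μ , x ⟩) +_) (actW-orthogonal v μ x) ⟨
    (k - ⟨ μ , x ⟩) + ⟨ actW R v μ , actW R v x ⟩           ∎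
    where
    open ≡-Reasoning
    x = corootLattice R r

  actŴ-preimage : ∀ v r τ c → actŴ R (v ·t r) (actW R (reverse v) τ , c + ⟨ τ , vr R (v ·t r) ⟩) ≡ (τ , c)
  actŴ-preimage v r τ c = cong₂ _,_ (actW-reverse-inverseʳ v τ) (begin
    (c + ⟨ τ , actW R v x ⟩) - ⟨ actW R (reverse v) τ , x ⟩  ≡⟨ sym (cong (λ t → (c + ⟨ τ , actW R v x ⟩) - t) (actW-isometry.adjoint v τ x)) ⟩
    (c + ⟨ τ , actW R v x ⟩) - ⟨ τ , actW R v x ⟩            ≡⟨ solve 2 (λ c a → (c :+ a) :- a := c) refl c ⟨ τ , actW R v x ⟩ ⟩
    c                                                      ∎)
    where
    open ≡-Reasoning
    x = corootLattice R r

  preimage-levels-bounded⇔ : ∀ w τ c b → (∀ μ k → actŴ R w (μ , k) ≡ (τ , c) → k ≤ b) ⇔ (c + ⟨ τ , vr R w ⟩ ≤ b)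
  preimage-levels-bounded⇔ (v ·t r) τ c b = mk⇔
    (λ bounded → bounded _ _ (actŴ-preimage v r τ c))
    (λ c+τx≤b μ k w[μ,k]≡[τ,c] → subst (_≤ b) (sym (actŴ-level v r w[μ,k]≡[τ,c])) c+τx≤b)

  simple-preimage-levels-bounded⇔ : ∀ w i b →
    (∀ μ k → actŴ R w (μ , k) ≡ (simple i , 0ℚ) → k ≤ b) ⇔ (⟨ vr R w , simple i ⟩ ≤ b)
  simple-preimage-levels-bounded⇔ w i b = mk⇔
    (λ bounded → subst (_≤ b) level≡ (to (preimage-levels-bounded⇔ w (simple i) 0ℚ b) bounded))
    (λ ≤b → from (preimage-levels-bounded⇔ w (simple i) 0ℚ b) (subst (_≤ b) (sym level≡) ≤b))
    where
    open Equivalence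
    level≡ : 0ℚ + ⟨ simple i , vr R w ⟩ ≡ ⟨ vr R w , simple i ⟩
    level≡ = trans (ℚP.+-identityˡ ⟨ simple i , vr R w ⟩) (⟨⟩-sym (simple i) (vr R w))

  α₀-preimage-levels-bounded⇔ : ∀ w →
    (∀ μ k → actŴ R w (μ , k) ≡ (negv θ , 1ℚ) → k ≤ 0ℚ) ⇔ (1ℚ ≤ ⟨ vr R w , θ ⟩)
  α₀-preimage-levels-bounded⇔ w = mk⇔
    (λ bounded → to (p-q≤0⇔p≤q 1ℚ ⟨ vr R w , θ ⟩) (subst (_≤ 0ℚ) level≡ (to (preimage-levels-bounded⇔ w (negv θ) 1ℚ 0ℚ) bounded)))
    (λ 1≤θ → from (preimage-levels-bounded⇔ w (negv θ) 1ℚ 0ℚ) (subst (_≤ 0ℚ) (sym level≡) (from (p-q≤0⇔p≤q 1ℚ ⟨ vr R w , θ ⟩) 1≤θ)))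
    where
    open Equivalence
    level≡ : 1ℚ + ⟨ negv θ , vr R w ⟩ ≡ 1ℚ - ⟨ vr R w , θ ⟩
    level≡ = cong (1ℚ +_) (trans (⟨⟩-negˡ θ (vr R w)) (cong -_ (⟨⟩-sym θ (vr R w))))

  SMaximal⇔ : ∀ w → SMaximal R w ⇔ (Dominant R w × InDmax R (vr R w) × InQ∨ R (vr R w))
  SMaximal⇔ w = mk⇔ forward backward
    where
    open Equivalence
    forward : SMaximal R w → Dominant R w × InDmax R (vr R w) × InQ∨ R (vr R w)
    forward (dom , short , long , α₀) =
      dom , ((λ i isShort → to (simple-preimage-levels-bounded⇔ w i 1ℚ) (short i isShort)) ,
             (λ i isLong  → to (simple-preimage-levels-bounded⇔ w i 0ℚ) (long i isLong)) ,
             to (α₀-preimage-levels-bounded⇔ w) α₀) ,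
      actW-InQ∨ (Ŵ.v w) (Ŵ.r w , refl)
    backward : Dominant R w × InDmax R (vr R w) × InQ∨ R (vr R w) → SMaximal R w
    backward (dom , (short , long , α₀) , _) =
      dom , (λ i isShort → from (simple-preimage-levels-bounded⇔ w i 1ℚ) (short i isShort)) ,
            (λ i isLong  → from (simple-preimage-levels-bounded⇔ w i 0ℚ) (long i isLong)) ,
            from (α₀-preimage-levels-bounded⇔ w) α₀

  -- Dominance and injectivity

  -- γ - (γ, x)δ is a positive affine root, up to the integrality of (γ, x)
  PositiveAt : V n → V n → Set
  PositiveAt x γ = ⟨ γ , x ⟩ < 0ℚ ⊎ (⟨ γ , x ⟩ ≡ 0ℚ × InQ⁺ γ)

  module _ {x : V n} where

    PositiveAt⇒≤0 : ∀ {γ} → PositiveAt x γ → ⟨ γ , x ⟩ ≤ 0ℚ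
    PositiveAt⇒≤0 (inj₁ γx<0)       = ℚP.<⇒≤ γx<0
    PositiveAt⇒≤0 (inj₂ (γx≡0 , _)) = ℚP.≤-reflexive γx≡0

    PositiveAt-0v : PositiveAt x 0v
    PositiveAt-0v = inj₂ (⟨⟩-0ˡ x , InQ⁺-0v)

    PositiveAt-+ : ∀ {γ γ′} → PositiveAt x γ → PositiveAt x γ′ → PositiveAt x (γ +v γ′)
    PositiveAt-+ {γ} {γ′} (inj₂ (γx≡0 , γ∈Q⁺)) (inj₂ (γ′x≡0 , γ′∈Q⁺)) =
      inj₂ (trans (⟨⟩-+ˡ γ γ′ x) (cong₂ _+_ γx≡0 γ′x≡0) , InQ⁺-+ γ∈Q⁺ γ′∈Q⁺)
    PositiveAt-+ {γ} {γ′} (inj₁ γx<0) γ′>0 =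
      inj₁ (subst (_< 0ℚ) (sym (⟨⟩-+ˡ γ γ′ x)) (ℚP.+-mono-<-≤ γx<0 (PositiveAt⇒≤0 γ′>0)))
    PositiveAt-+ {γ} {γ′} γ>0@(inj₂ _) (inj₁ γ′x<0) =
      inj₁ (subst (_< 0ℚ) (sym (⟨⟩-+ˡ γ γ′ x)) (ℚP.+-mono-≤-< (PositiveAt⇒≤0 γ>0) γ′x<0))

    PositiveAt-ℕ· : ∀ a {γ} → PositiveAt x γ → PositiveAt x (ℕ→ℚ a ·v γ)
    PositiveAt-ℕ· zero    {γ} _ = subst (PositiveAt x) (sym (0·v≡0v γ)) PositiveAt-0v
    PositiveAt-ℕ· (suc a) {γ} (inj₁ γx<0) = inj₁ (begin-strict
      ⟨ ℕ→ℚ (suc a) ·v γ , x ⟩   ≡⟨ ⟨⟩-·ˡ (ℕ→ℚ (suc a)) γ x ⟩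
      ℕ→ℚ (suc a) * ⟨ γ , x ⟩    <⟨ ℚP.*-monoʳ-<-pos (ℕ→ℚ (suc a)) {{ℚ.positive (ℕ→ℚ-pos a)}} γx<0 ⟩
      ℕ→ℚ (suc a) * 0ℚ           ≡⟨ ℚP.*-zeroʳ (ℕ→ℚ (suc a)) ⟩
      0ℚ                         ∎)
      where open ℚP.≤-Reasoning
    PositiveAt-ℕ· (suc a) {γ} (inj₂ (γx≡0 , γ∈Q⁺)) =
      inj₂ (trans (⟨⟩-·ˡ (ℕ→ℚ (suc a)) γ x) (trans (cong (ℕ→ℚ (suc a) *_) γx≡0) (ℚP.*-zeroʳ (ℕ→ℚ (suc a)))) ,
            InQ⁺-ℕ· (suc a) γ∈Q⁺)

    PositiveAt-lincomb : ∀ {k} (c : Fin k → ℕ) (γs : Fin k → V n) →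
                         (∀ j → PositiveAt x (γs j)) → PositiveAt x (lincomb (λ j → ℕ→ℚ (c j)) γs)
    PositiveAt-lincomb {zero}  c γs γs>0 = PositiveAt-0v
    PositiveAt-lincomb {suc k} c γs γs>0 =
      PositiveAt-+ (PositiveAt-ℕ· (c zero) (γs>0 zero)) (PositiveAt-lincomb (c ∘ suc) (γs ∘ suc) (γs>0 ∘ suc))

    PositiveAt-antisym : ∀ {γ} → PositiveAt x γ → PositiveAt x (negv γ) → γ ≡ 0v
    PositiveAt-antisym {γ} (inj₁ γx<0) -γ>0 = ⊥-elim (ℚP.<-irrefl refl (ℚP.<-≤-trans 0<-γx (PositiveAt⇒≤0 -γ>0)))
      where
      0<-γx : 0ℚ < ⟨ negv γ , x ⟩
      0<-γx = subst (0ℚ <_) (sym (⟨⟩-negˡ γ x)) (ℚP.neg-antimono-< γx<0)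
    PositiveAt-antisym {γ} (inj₂ (γx≡0 , _)) (inj₁ -γx<0) =
      ⊥-elim (ℚP.<-irrefl (trans (⟨⟩-negˡ γ x) (cong -_ γx≡0)) -γx<0)
    PositiveAt-antisym (inj₂ (_ , γ∈Q⁺)) (inj₂ (_ , -γ∈Q⁺)) = InQ⁺-pointed γ∈Q⁺ -γ∈Q⁺

    PositiveAt-dichotomy : ∀ {γ} → γ ∈ Δ → PositiveAt x γ ⊎ PositiveAt x (negv γ)
    PositiveAt-dichotomy {γ} γ∈Δ = by-cmp (ℚP.<-cmp ⟨ γ , x ⟩ 0ℚ)
      where
      ⟨-γ,x⟩ : ⟨ negv γ , x ⟩ ≡ - ⟨ γ , x ⟩
      ⟨-γ,x⟩ = ⟨⟩-negˡ γ x
      by-sign : ⟨ γ , x ⟩ ≡ 0ℚ → InQ⁺ γ ⊎ InQ⁺ (negv γ) → PositiveAt x γ ⊎ PositiveAt x (negv γ)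
      by-sign γx≡0 (inj₁ γ∈Q⁺)  = inj₁ (inj₂ (γx≡0 , γ∈Q⁺))
      by-sign γx≡0 (inj₂ -γ∈Q⁺) = inj₂ (inj₂ (trans ⟨-γ,x⟩ (cong -_ γx≡0) , -γ∈Q⁺))
      by-cmp : Tri (⟨ γ , x ⟩ < 0ℚ) (⟨ γ , x ⟩ ≡ 0ℚ) (⟨ γ , x ⟩ > 0ℚ) → PositiveAt x γ ⊎ PositiveAt x (negv γ)
      by-cmp (tri< γx<0 _ _) = inj₁ (inj₁ γx<0)
      by-cmp (tri≈ _ γx≡0 _) = by-sign γx≡0 (root-sign γ∈Δ)
      by-cmp (tri> _ _ γx>0) = inj₂ (inj₁ (subst (_< 0ℚ) (sym ⟨-γ,x⟩) (ℚP.neg-antimono-< γx>0)))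

    PositiveAt? : ∀ {γ} → γ ∈ Δ → Dec (PositiveAt x γ)
    PositiveAt? γ∈Δ with PositiveAt-dichotomy γ∈Δ
    ... | inj₁ γ>0  = yes γ>0
    ... | inj₂ -γ>0 = no λ γ>0 → nonzero γ∈Δ (PositiveAt-antisym γ>0 -γ>0)

  ⟨vαᵢ,vr⟩ : ∀ v r i → ⟨ actW R v (simple i) , vr R (v ·t r) ⟩ ≡ ⟨ simple i , corootLattice R r ⟩
  ⟨vαᵢ,vr⟩ v r i = actW-orthogonal v (simple i) (corootLattice R r)

  Dominant⇒PositiveAt : ∀ v r → Dominant R (v ·t r) → ∀ i → PositiveAt (vr R (v ·t r)) (actW R v (simple i))
  Dominant⇒PositiveAt v r dom i = from-level (proj₂ (dom i))
    where
    a = ⟨ simple i , corootLattice R r ⟩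
    from-level : (0ℚ - a ≡ 0ℚ × Positive R (actW R v (simple i))) ⊎ (∃ λ m → 0ℚ - a ≡ ℕ→ℚ (suc m)) →
                 PositiveAt (vr R (v ·t r)) (actW R v (simple i))
    from-level (inj₁ (0-a≡0 , _ , vαᵢ∈Q⁺)) = inj₂ (trans (⟨vαᵢ,vr⟩ v r i) (0-q≡0⇒q≡0 0-a≡0) , vαᵢ∈Q⁺)
    from-level (inj₂ (m , 0-a≡1+m))        = inj₁ (subst (_< 0ℚ) (sym (⟨vαᵢ,vr⟩ v r i)) (0-q≡1+m⇒q<0 {a} {m} 0-a≡1+m))

  PositiveAt⇒Dominant : ∀ v r → (∀ i → PositiveAt (vr R (v ·t r)) (actW R v (simple i))) → Dominant R (v ·t r)
  PositiveAt⇒Dominant v r vΠ>0 i = actW-root v (simple-in i) , to-level (vΠ>0 i)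
    where
    a = ⟨ simple i , corootLattice R r ⟩
    a-integral : ∃ λ z → a ≡ ℤ→ℚ z
    a-integral = let z , ra≡z = InQ∨-integral (r , refl) i in z , trans (⟨⟩-sym (simple i) (corootLattice R r)) ra≡z
    to-level : PositiveAt (vr R (v ·t r)) (actW R v (simple i)) →
               (0ℚ - a ≡ 0ℚ × Positive R (actW R v (simple i))) ⊎ (∃ λ m → 0ℚ - a ≡ ℕ→ℚ (suc m))
    to-level (inj₂ (vαᵢx≡0 , vαᵢ∈Q⁺)) =
      inj₁ (cong (λ t → 0ℚ - t) (trans (sym (⟨vαᵢ,vr⟩ v r i)) vαᵢx≡0) , actW-root v (simple-in i) , vαᵢ∈Q⁺)
    to-level (inj₁ vαᵢx<0) = inj₂ let z , a≡z = a-integral in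
      subst (λ t → ∃ λ m → 0ℚ - t ≡ ℕ→ℚ (suc m)) (sym a≡z)
        (ℤ→ℚ<0⇒0-ℤ→ℚ≡1+m z (subst (_< 0ℚ) (trans (⟨vαᵢ,vr⟩ v r i) a≡z) vαᵢx<0))

  PositiveAt-words-agree : ∀ x v v′ → (∀ i → PositiveAt x (actW R v (simple i))) →
                           (∀ i → PositiveAt x (actW R v′ (simple i))) → ∀ y → actW R v y ≡ actW R v′ y
  PositiveAt-words-agree x v v′ vΠ>0 v′Π>0 y = trans (v≗v′u y) (cong (actW R v′) (u≗id y))
    where
    open ≡-Reasoning
    u = reverse v′ ++ v
    K = proj₁ (word-as-simple-word u)
    u≗K : ∀ y → actW R u y ≡ actS K y
    u≗K = proj₂ (word-as-simple-word u)
    v≗v′u : ∀ y → actW R v y ≡ actW R v′ (actW R u y)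
    v≗v′u y = begin
      actW R v y                                   ≡⟨ actW-reverse-inverseʳ v′ (actW R v y) ⟨
      actW R v′ (actW R (reverse v′) (actW R v y)) ≡⟨ cong (actW R v′) (actW-++ (reverse v′) v y) ⟨
      actW R v′ (actW R u y)                       ∎
    KΠ>0 : ∀ j → InQ⁺ (actS K (simple j))
    KΠ>0 j = by-sign (root-sign (actS-root K (simple-in j)))
      where
      αⱼ = simple j
      by-sign : InQ⁺ (actS K αⱼ) ⊎ InQ⁺ (negv (actS K αⱼ)) → InQ⁺ (actS K αⱼ)
      by-sign (inj₁ Kαⱼ>0)        = Kαⱼ>0
      by-sign (inj₂ (c , -Kαⱼ≡c)) = ⊥-elim (nonzero (actW-root v (simple-in j))
        (PositiveAt-antisym {x} (vΠ>0 j)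
          (subst (PositiveAt x) (sym -vαⱼ≡c) (PositiveAt-lincomb {x} c (λ l → actW R v′ (simple l)) v′Π>0))))
        where
        -vαⱼ≡c : negv (actW R v αⱼ) ≡ lincomb (λ l → ℕ→ℚ (c l)) (λ l → actW R v′ (simple l))
        -vαⱼ≡c = begin
          negv (actW R v αⱼ)                 ≡⟨ cong negv (trans (v≗v′u αⱼ) (cong (actW R v′) (u≗K αⱼ))) ⟩
          negv (actW R v′ (actS K αⱼ))       ≡⟨ actW-isometry.f-negv v′ (actS K αⱼ) ⟨
          actW R v′ (negv (actS K αⱼ))       ≡⟨ cong (actW R v′) -Kαⱼ≡c ⟩
          actW R v′ (ℕ-comb c)               ≡⟨ actW-isometry.f-lincomb v′ (λ l → ℕ→ℚ (c l)) simple ⟩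
          lincomb (λ l → ℕ→ℚ (c l)) (λ l → actW R v′ (simple l)) ∎
    u≗id : ∀ y → actW R u y ≡ y
    u≗id y = trans (u≗K y) (positive-on-simple⇒identity K (<-wellFounded (length K)) KΠ>0 y)

  dominant-vr-injective : ∀ w w′ → Dominant R w → Dominant R w′ → vr R w ≡ vr R w′ → _≈Ŵ_ R w w′
  dominant-vr-injective (v ·t r) (v′ ·t r′) dom dom′ x≡x′ (μ , k) =
    cong₂ _,_ (v≗v′ μ) (cong (λ t → k - ⟨ μ , t ⟩) r≡r′)
    where
    open ≡-Reasoning
    x = vr R (v ·t r)
    v≗v′ : ∀ y → actW R v y ≡ actW R v′ y
    v≗v′ = PositiveAt-words-agree x v v′ (Dominant⇒PositiveAt v r dom) λ i →
      subst (λ t → PositiveAt t (actW R v′ (simple i))) (sym x≡x′) (Dominant⇒PositiveAt v′ r′ dom′ i)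
    r≡r′ : corootLattice R r ≡ corootLattice R r′
    r≡r′ = begin
      corootLattice R r                                      ≡⟨ actW-reverse-inverseˡ v (corootLattice R r) ⟨
      actW R (reverse v) x                                   ≡⟨ cong (actW R (reverse v)) (trans x≡x′ (sym (v≗v′ (corootLattice R r′)))) ⟩
      actW R (reverse v) (actW R v (corootLattice R r′))     ≡⟨ actW-reverse-inverseˡ v (corootLattice R r′) ⟩
      corootLattice R r′                                     ∎

  -- Surjectivity

  _≟v_ : DecidableEquality (V n)
  _≟v_ = VecP.≡-dec _≟_

  open import Data.List.Membership.DecPropositional _≟v_ using (_∈?_)

  Positive? : ∀ γ → Dec (Positive R γ)
  Positive? γ with γ ∈? Δ
  ... | no  γ∉Δ = no (γ∉Δ ∘ proj₁)
  ... | yes γ∈Δ = by-sign (root-sign γ∈Δ)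
    where
    by-sign : InQ⁺ γ ⊎ InQ⁺ (negv γ) → Dec (Positive R γ)
    by-sign (inj₁ γ>0)  = yes (γ∈Δ , γ>0)
    by-sign (inj₂ -γ>0) = no λ (_ , γ>0) → nonzero γ∈Δ (InQ⁺-pointed γ>0 -γ>0)

  positive-roots : List (V n)
  positive-roots = deduplicate _≟v_ (filter Positive? Δ)

  positive-roots-unique : Unique positive-roots
  positive-roots-unique = UniqueDecP.deduplicate-! _≟v_ (filter Positive? Δ)

  ∈-positive-roots⁺ : ∀ {γ} → Positive R γ → γ ∈ positive-roots
  ∈-positive-roots⁺ γ>0@(γ∈Δ , _) = ∈-deduplicate⁺ _≟v_ (∈-filter⁺ Positive? γ∈Δ γ>0)

  ∈-positive-roots⁻ : ∀ {γ} → γ ∈ positive-roots → Positive R γ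
  ∈-positive-roots⁻ γ∈Δ⁺ = proj₂ (∈-filter⁻ Positive? {xs = Δ} (∈-deduplicate⁻ _≟v_ (filter Positive? Δ) γ∈Δ⁺))

  module _ (x : V n) where

    RootPositiveAt : V n → Set
    RootPositiveAt γ = γ ∈ Δ × PositiveAt x γ

    RootPositiveAt? : ∀ γ → Dec (RootPositiveAt γ)
    RootPositiveAt? γ with γ ∈? Δ
    ... | no  γ∉Δ = no (γ∉Δ ∘ proj₁)
    ... | yes γ∈Δ = Dec.map′ (γ∈Δ ,_) proj₂ (PositiveAt? {x} γ∈Δ)

    misplaced : SimpleWord → List (V n)
    misplaced K = filter (λ β → ¬? (RootPositiveAt? (actS K β))) positive-roots

    ∈-misplaced⁺ : ∀ {K β} → Positive R β → ¬ RootPositiveAt (actS K β) → β ∈ misplaced K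
    ∈-misplaced⁺ {K} β>0 Kβ≯0 = ∈-filter⁺ (λ β → ¬? (RootPositiveAt? (actS K β))) (∈-positive-roots⁺ β>0) Kβ≯0

    ∈-misplaced⁻ : ∀ {K β} → β ∈ misplaced K → Positive R β × ¬ RootPositiveAt (actS K β)
    ∈-misplaced⁻ {K} β∈ = let β∈Δ⁺ , Kβ≯0 = ∈-filter⁻ (λ β → ¬? (RootPositiveAt? (actS K β))) {xs = positive-roots} β∈
      in ∈-positive-roots⁻ β∈Δ⁺ , Kβ≯0

    sᵢ-misplaced⊆misplaced : ∀ K i → ¬ PositiveAt x (actS K (simple i)) →
                             ∀ {β} → β ∈ misplaced (K ∷ʳ i) → s (simple i) β ∈ misplaced K
    sᵢ-misplaced⊆misplaced K i Kαᵢ≯0 {β} β∈ = ∈-misplaced⁺ {K} (sβ∈Δ , sβ>0 (β≡αᵢ⊎sᵢβ>0 i β∈Δ β>0)) Ksβ≯0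
      where
      αᵢ = simple i
      β∈Δ = proj₁ (proj₁ (∈-misplaced⁻ {K ∷ʳ i} β∈))
      β>0 = proj₂ (proj₁ (∈-misplaced⁻ {K ∷ʳ i} β∈))
      sβ∈Δ = refl-closed (simple-in i) β∈Δ
      Ksβ≯0 : ¬ RootPositiveAt (actS K (s αᵢ β))
      Ksβ≯0 = proj₂ (∈-misplaced⁻ {K ∷ʳ i} β∈) ∘ subst RootPositiveAt (sym (actS-++ K [ i ] β))
      -Kαᵢ>0 : PositiveAt x (negv (actS K αᵢ))
      -Kαᵢ>0 with PositiveAt-dichotomy {x} (actS-root K (simple-in i))
      ... | inj₁ Kαᵢ>0  = ⊥-elim (Kαᵢ≯0 Kαᵢ>0)
      ... | inj₂ -Kαᵢ>0 = -Kαᵢ>0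
      sβ>0 : β ≡ αᵢ ⊎ InQ⁺ (s αᵢ β) → InQ⁺ (s αᵢ β)
      sβ>0 (inj₂ sβ>0) = sβ>0
      sβ>0 (inj₁ β≡αᵢ) = ⊥-elim (Ksβ≯0 (actS-root K sβ∈Δ , subst (PositiveAt x) (sym (begin
        actS K (s αᵢ β)     ≡⟨ cong (λ γ → actS K (s αᵢ γ)) β≡αᵢ ⟩
        actS K (s αᵢ αᵢ)    ≡⟨ cong (actS K) (s-root (simple-in i)) ⟩
        actS K (negv αᵢ)    ≡⟨ actS-isometry.f-negv K αᵢ ⟩
        negv (actS K αᵢ)    ∎)) -Kαᵢ>0))
        where open ≡-Reasoning

    misplaced-decreasing : ∀ K i → ¬ PositiveAt x (actS K (simple i)) →
                           length (misplaced (K ∷ʳ i)) ℕ.< length (misplaced K)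
    misplaced-decreasing K i Kαᵢ≯0 = subst (ℕ._< length (misplaced K)) (LP.length-map (s αᵢ) (misplaced (K ∷ʳ i)))
      (Unique-⊂⇒length-< sᵢ-misplaced-unique sᵢ-misplaced⊆ αᵢ∈misplaced αᵢ∉sᵢ-misplaced)
      where
      αᵢ = simple i
      sᵢ-misplaced = List.map (s αᵢ) (misplaced (K ∷ʳ i))
      sᵢ-misplaced-unique : Unique sᵢ-misplaced
      sᵢ-misplaced-unique = UniqueP.map⁺ (s-injective (simple-in i))
        (UniqueP.filter⁺ (λ β → ¬? (RootPositiveAt? (actS (K ∷ʳ i) β))) positive-roots-unique)
      sᵢ-misplaced⊆ : ∀ {z} → z ∈ sᵢ-misplaced → z ∈ misplaced K
      sᵢ-misplaced⊆ z∈ = let β , β∈ , z≡sβ = ∈-map⁻ (s αᵢ) z∈ in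
        subst (_∈ misplaced K) (sym z≡sβ) (sᵢ-misplaced⊆misplaced K i Kαᵢ≯0 β∈)
      αᵢ∈misplaced : αᵢ ∈ misplaced K
      αᵢ∈misplaced = ∈-misplaced⁺ {K} (simple-in i , simple-InQ⁺ i) (Kαᵢ≯0 ∘ proj₂)
      αᵢ∉sᵢ-misplaced : αᵢ ∉ sᵢ-misplaced
      αᵢ∉sᵢ-misplaced αᵢ∈ = let β , β∈ , αᵢ≡sβ = ∈-map⁻ (s αᵢ) αᵢ∈ in
        nonzero (simple-in i) (InQ⁺-pointed (simple-InQ⁺ i) (subst InQ⁺ (β≡-αᵢ αᵢ≡sβ) (proj₂ (proj₁ (∈-misplaced⁻ {K ∷ʳ i} β∈)))))
        where
        β≡-αᵢ : ∀ {β} → αᵢ ≡ s αᵢ β → β ≡ negv αᵢ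
        β≡-αᵢ {β} αᵢ≡sβ = trans (sym (s-involutive (simple-in i) β)) (trans (cong (s αᵢ) (sym αᵢ≡sβ)) (s-root (simple-in i)))

    word-sending-simple-roots-PositiveAt : ∀ K → Acc ℕ._<_ (length (misplaced K)) →
                             ∃ λ K′ → ∀ i → PositiveAt x (actS K′ (simple i))
    word-sending-simple-roots-PositiveAt K (acc smaller) = by-all (FinP.all? KΠ>0?)
      where
      KΠ>0? : ∀ i → Dec (PositiveAt x (actS K (simple i)))
      KΠ>0? i = PositiveAt? {x} (actS-root K (simple-in i))
      by-all : Dec (∀ i → PositiveAt x (actS K (simple i))) → ∃ λ K′ → ∀ i → PositiveAt x (actS K′ (simple i))
      by-all (yes KΠ>0)  = K , KΠ>0
      by-all (no  KΠ≯0) = let i , Kαᵢ≯0 = FinP.¬∀⟶∃¬ p _ KΠ>0? KΠ≯0 in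
        word-sending-simple-roots-PositiveAt (K ∷ʳ i) (smaller (misplaced-decreasing K i Kαᵢ≯0))

  surjective : ∀ x → InDmax R x → InQ∨ R x → ∃ λ w → SMaximal R w × vr R w ≡ x
  surjective x x∈D x∈Q∨ =
    w , from (SMaximal⇔ w) (dom , subst (InDmax R) (sym w-x≡x) x∈D , subst (InQ∨ R) (sym w-x≡x) x∈Q∨) , w-x≡x
    where
    open Equivalence
    K = proj₁ (word-sending-simple-roots-PositiveAt x [] (<-wellFounded _))
    KΠ>0 : ∀ i → PositiveAt x (actS K (simple i))
    KΠ>0 = proj₂ (word-sending-simple-roots-PositiveAt x [] (<-wellFounded _))
    r = proj₁ (actS-InQ∨ (reverse K) x∈Q∨)
    w = word K ·t r
    w-x≡x : vr R w ≡ x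
    w-x≡x = trans (cong (actS K) (sym (proj₂ (actS-InQ∨ (reverse K) x∈Q∨)))) (actS-reverse-inverseʳ K x)
    dom : Dominant R w
    dom = PositiveAt⇒Dominant (word K) r λ i → subst (λ t → PositiveAt t (actS K (simple i))) (sym w-x≡x) (KΠ>0 i)

proposition5p8 : (R : RootSystem) →
    ((w : Ŵ R) → SMaximal R w ⇔ (Dominant R w × InDmax R (vr R w) × InQ∨ R (vr R w)))
    × ((∀ w → SMaximal R w → InDmax R (vr R w) × InQ∨ R (vr R w))
    × (∀ w w' → SMaximal R w → SMaximal R w' → vr R w ≡ vr R w' → _≈Ŵ_ R w w')
    × (∀ x → InDmax R x → InQ∨ R x → ∃ λ w → SMaximal R w × vr R w ≡ x))
proposition5p8 R =
  SMaximal⇔ R ,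
  (λ w w-smax → proj₂ (Equivalence.to (SMaximal⇔ R w) w-smax)) ,
  (λ w w′ w-smax w′-smax → dominant-vr-injective R w w′ (proj₁ w-smax) (proj₁ w′-smax)) ,
  surjective R
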